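{- Let $\Sigma$ be an alphabet of size $\sigma \ge 2$ and $T$ a string of length $n$ over $\Sigma$. For any $1 < i \le j \le n$, \[ |\mathsf{MUS}(T[i-1..j]) \bigtriangleup \mathsf{MUS}(T[i..j])| \le 4 \quad\text{and}\quad -1 \le |\mathsf{MUS}(T[i-1..j])| - |\mathsf{MUS}(T[i..j])| \le 2 . \] Furthermore, these bounds are tight for any $\sigma, i, j$ with $\sigma \ge 3$, $1 < i \le j \le n$ and $j-i+1 \ge 5$: for such parameters each of the three bounds (the value $4$, the value $2$, and the value $-1$) is attained by some string $T$ over an alphabet of size $\sigma$.
   Context: For a string $W$, $W[k]$ is its $k$-th character and $W[a..b]$ is the substring from position $a$ to position $b$ (the empty string $\varepsilon$ if $a > b$). For strings $w, W$, $\#\mathit{occ}_W(w)$ is the number of positions at which $w$ occurs in $W$, with the convention $\#\mathit{occ}_W(\varepsilon) = |W|+1$. A substring $w$ of $W$ is unique in $W$ if $\#\mathit{occ}_W(w)=1$ and repeating in $W$ if $\#\mathit{occ}_W(w)\ge 2$. For $1 \le i \le j \le n$, $\mathsf{MUS}(T[i..j])$ is the set of intervals $[s,t]$ with $i \le s \le t \le j$ (positions refer to $T$) such that $T[s..t]$ is unique in $T[i..j]$ and both $T[s+1..t]$ and $T[s..t-1]$ are repeating in $T[i..j]$ (these are the minimal unique substrings of the window $T[i..j]$). $\bigtriangleup$ denotes symmetric difference. -}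

module Defs where

open import Data.Nat using (ℕ; zero; suc; _+_; _∸_; _≤_; _≤?_)
open import Data.Nat.Properties using () renaming (_≟_ to _≟ℕ_)
open import Data.Fin using (Fin)
open import Data.Fin.Properties using () renaming (_≟_ to _≟F_)
open import Data.Vec using (Vec; toList)
open import Data.List using (List; []; _∷_; length; take; drop; filter; upTo; concatMap; map)
open import Data.List.Properties using (≡-dec)
open import Data.Product using (_×_; _,_; proj₁; proj₂)
open import Data.Product.Properties using () renaming (≡-dec to ×-≡-dec)
open import Relation.Nullary using (Dec; ¬_; ¬?)
open import Relation.Nullary.Decidable using (_×-dec_)
open import Relation.Binary.PropositionalEquality using (_≡_)
import Data.List.Membership.DecPropositional as DecMem

Str : ℕ → Set
Str σ = List (Fin σ)

-- W[a..b] with 1-based positions; empty if a > b.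
sub : ∀ {σ} → Str σ → ℕ → ℕ → Str σ
sub W a b = take (suc b ∸ a) (drop (a ∸ 1) W)

-- #occ_W(w): number of positions k ∈ {0..|W|} at which w occurs in W
-- (for w = ε this is |W|+1, matching the convention).
occ : ∀ {σ} → Str σ → Str σ → ℕ
occ w W = length (filter (λ k → ≡-dec _≟F_ (take (length w) (drop k W)) w)
                         (upTo (suc (length W))))

Unique : ∀ {σ} → Str σ → Str σ → Set
Unique w W = occ w W ≡ 1

Repeating : ∀ {σ} → Str σ → Str σ → Set
Repeating w W = 2 ≤ occ w W

-- [s,t] ∈ MUS(T[i..j])  (positions refer to T, 1-based)
IsMUS : ∀ {σ} → Str σ → ℕ → ℕ → ℕ × ℕ → Set
IsMUS T i j (s , t) =
  i ≤ s × s ≤ t × t ≤ j ×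
  Unique (sub T s t) W × Repeating (sub T (suc s) t) W × Repeating (sub T s (t ∸ 1)) W
  where W = sub T i j

isMUS? : ∀ {σ} (T : Str σ) i j p → Dec (IsMUS T i j p)
isMUS? T i j (s , t) =
  (i ≤? s) ×-dec (s ≤? t) ×-dec (t ≤? j) ×-dec
  (occ (sub T s t) W ≟ℕ 1) ×-dec (2 ≤? occ (sub T (suc s) t) W) ×-dec
  (2 ≤? occ (sub T s (t ∸ 1)) W)
  where W = sub T i j

candidates : ℕ → List (ℕ × ℕ)
candidates j = concatMap (λ s → map (λ t → s , t) (upTo (suc j))) (upTo (suc j))

MUS : ∀ {σ n} → Vec (Fin σ) n → ℕ → ℕ → List (ℕ × ℕ)
MUS T i j = filter (isMUS? (toList T) i j) (candidates j)

open DecMem (×-≡-dec _≟ℕ_ _≟ℕ_) using (_∈?_)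

-- |A \ B| + |B \ A|  (size of symmetric difference of duplicate-free lists)
symDiffSize : List (ℕ × ℕ) → List (ℕ × ℕ) → ℕ
symDiffSize A B = length (filter (λ p → ¬? (p ∈? B)) A) + length (filter (λ p → ¬? (p ∈? A)) B)

-- Write the longer window as cV = c ∷ V, with V = T[i..j].  A MUS of V that is not a MUS
-- of cV has gained an occurrence at the front of cV, i.e. it is a prefix of cV; two such
-- prefixes would nest, so at most one MUS is lost.  A MUS of cV that is not a MUS of V
-- either starts at c, or lies inside V and has a shortening (drop its last or its first
-- letter) that repeats in cV only because it is a prefix of cV occurring exactly twice;
-- each of these three kinds has at most one member, so at most three MUSs appear.  In the
-- last two cases the shortest prefix of cV occurring at most twice is a lost MUS, so two
-- or three new MUSs force a lost one: -1 ≤ |MUS(cV)| - |MUS(V)| ≤ 2 and the symmetric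
-- difference has at most 3 + 1 elements.  Padding the windows 1 2 2 1 0 0… and
-- 1 1 2 1 1 0… with 0s attains the bounds.

module Submission where

open import Defs hiding (Unique)
open import Data.Nat using (ℕ; zero; suc; _+_; _∸_; _≤_; _<_; _≤?_; z≤n; s≤s; _⊓_)
open import Data.Nat.Properties
open import Data.Fin as Fin using (Fin)
open import Data.Fin.Properties using () renaming (_≟_ to _≟F_)
open import Data.List using (List; []; _∷_; _++_; length; replicate; take; drop; filter; upTo; applyUpTo; map; concatMap; cartesianProduct)
open import Data.List.Properties using (∷-injectiveˡ; ∷-injectiveʳ; length-++; length-replicate; ≡-dec; length-take; length-drop; take-take; drop-drop; take-[]; filter-accept; filter-reject)
open import Data.List.Membership.Propositional using (_∈_)
open import Data.List.Membership.Propositional.Properties using (∈-filter⁺; ∈-filter⁻; ∈-upTo⁺; ∈-upTo⁻; ∈-cartesianProduct⁺; ∈-length)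
import Data.List.Membership.DecPropositional as DecMembership
open import Data.List.Relation.Binary.Subset.Propositional using (_⊆_)
open import Data.List.Relation.Unary.Any using (here; there)
open import Data.List.Relation.Unary.All using (All; []; _∷_) renaming (lookup to All-lookup)
open import Data.List.Relation.Unary.Unique.Propositional using (Unique; []; _∷_)
open import Data.List.Relation.Unary.Unique.Propositional.Properties using (upTo⁺; filter⁺; cartesianProduct⁺)
open import Data.Product using (_×_; _,_; proj₁; proj₂; ∃; ∃-syntax)
open import Data.Product.Properties using () renaming (≡-dec to ×-≡-dec)
open import Data.Sum using (_⊎_; inj₁; inj₂; [_,_]′) renaming (map to ⊎-map)
open import Data.Empty using (⊥; ⊥-elim)
open import Relation.Nullary using (Dec; yes; no; does; ¬_; ¬?; contradiction)
open import Data.Bool using (if_then_else_)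
open import Relation.Nullary.Decidable using (_×-dec_)
open import Relation.Binary using (DecidableEquality; tri<; tri≈; tri>)
open import Relation.Unary using (Pred; Decidable)
open import Relation.Binary.PropositionalEquality using (module ≡-Reasoning; _≡_; _≢_; refl; sym; trans; cong; cong₂; subst; subst₂)
open import Data.Integer using (+_; _-_; -1ℤ; _⊖_; -≤+; +≤+) renaming (_≤_ to _≤ℤ_)
open import Data.Integer.Properties using ([+m]-[+n]≡m⊖n; +-cancelˡ-⊖) renaming (≤-refl to ≤ℤ-refl)
open import Data.Vec using (Vec; toList; fromList)
open import Data.Vec.Properties using (length-toList; toList∘fromList)
open import Level using (0ℓ)
open import Function using (_∘′_)

module _ {A : Set} where

  Subsingleton : Pred A 0ℓ → Set
  Subsingleton P = ∀ {x y} → P x → P y → x ≡ y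

  private
    remove : ∀ {y} (zs : List A) → y ∈ zs →
             ∃[ zs′ ] (length zs ≡ suc (length zs′) × (∀ {w} → w ∈ zs → w ≢ y → w ∈ zs′))
    remove (z ∷ zs) (here refl) = zs , refl , λ { (here w≡z) w≢z → contradiction w≡z w≢z ; (there w∈) _ → w∈ }
    remove (z ∷ zs) (there y∈zs) with remove zs y∈zs
    ... | zs′ , len , keep =
      z ∷ zs′ , cong suc len , λ { (here w≡z) _ → here w≡z ; (there w∈) w≢y → there (keep w∈ w≢y) }

  unique⊆⇒length≤ : ∀ {ys zs : List A} → Unique ys → ys ⊆ zs → length ys ≤ length zs
  unique⊆⇒length≤ {[]} _ _ = z≤n
  unique⊆⇒length≤ {y ∷ ys} {zs} (y∉ys ∷ u) ys⊆zs with remove zs (ys⊆zs (here refl))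
  ... | zs′ , len , keep = subst (suc (length ys) ≤_) (sym len)
        (s≤s (unique⊆⇒length≤ u (λ w∈ys → keep (ys⊆zs (there w∈ys)) (λ w≡y → All-lookup y∉ys w∈ys (sym w≡y)))))

  length-filter-mono : ∀ {P Q : Pred A 0ℓ} (P? : Decidable P) (Q? : Decidable Q) →
                       (∀ {x} → P x → Q x) → ∀ xs → length (filter P? xs) ≤ length (filter Q? xs)
  length-filter-mono P? Q? P⊆Q [] = z≤n
  length-filter-mono P? Q? P⊆Q (x ∷ xs) with P? x | Q? x
  ... | yes _  | yes _  = s≤s (length-filter-mono P? Q? P⊆Q xs)
  ... | yes px | no ¬qx = contradiction (P⊆Q px) ¬qx
  ... | no _   | yes _  = m≤n⇒m≤1+n (length-filter-mono P? Q? P⊆Q xs)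
  ... | no _   | no _   = length-filter-mono P? Q? P⊆Q xs

  length-filter-cong : ∀ {P Q : Pred A 0ℓ} (P? : Decidable P) (Q? : Decidable Q) xs →
                       (∀ {x} → x ∈ xs → P x → Q x) → (∀ {x} → x ∈ xs → Q x → P x) →
                       length (filter P? xs) ≡ length (filter Q? xs)
  length-filter-cong P? Q? [] _ _ = refl
  length-filter-cong P? Q? (x ∷ xs) P⇒Q Q⇒P with P? x | Q? x
  ... | yes _  | yes _  = cong suc (length-filter-cong P? Q? xs (P⇒Q ∘′ there) (Q⇒P ∘′ there))
  ... | yes px | no ¬qx = contradiction (P⇒Q (here refl) px) ¬qx
  ... | no ¬px | yes qx = contradiction (Q⇒P (here refl) qx) ¬px
  ... | no _   | no _   = length-filter-cong P? Q? xs (P⇒Q ∘′ there) (Q⇒P ∘′ there)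

  length-filter-filter : ∀ {P R : Pred A 0ℓ} (P? : Decidable P) (R? : Decidable R) xs →
                         length (filter R? (filter P? xs)) ≡ length (filter (λ x → P? x ×-dec R? x) xs)
  length-filter-filter P? R? [] = refl
  length-filter-filter P? R? (x ∷ xs) with P? x
  ... | no _ = length-filter-filter P? R? xs
  ... | yes _ with R? x
  ...   | yes _ = cong suc (length-filter-filter P? R? xs)
  ...   | no _  = length-filter-filter P? R? xs

  length-filter-split : ∀ {P Q : Pred A 0ℓ} (P? : Decidable P) (Q? : Decidable Q) xs →
                        length (filter P? xs) ≡
                        length (filter (λ x → P? x ×-dec Q? x) xs) + length (filter (λ x → P? x ×-dec ¬? (Q? x)) xs)
  length-filter-split P? Q? [] = refl
  length-filter-split P? Q? (x ∷ xs) with P? x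
  ... | no _ = length-filter-split P? Q? xs
  ... | yes _ with Q? x
  ...   | yes _ = cong suc (length-filter-split P? Q? xs)
  ...   | no _  = trans (cong suc (length-filter-split P? Q? xs)) (sym (+-suc _ _))

  filter-≥2⇒witness-≢ : (_≟_ : DecidableEquality A) {P : Pred A 0ℓ} (P? : Decidable P) {xs : List A} →
                        Unique xs → 2 ≤ length (filter P? xs) → (z : A) → ∃[ k ] (k ∈ xs × P k × k ≢ z)
  filter-≥2⇒witness-≢ _≟_ {P} P? {xs} u h z = pick (filter P? xs) (filter⁺ P? u) h (∈-filter⁻ P? {xs = xs})
    where
      pick : ∀ ys → Unique ys → 2 ≤ length ys → (∀ {k} → k ∈ ys → k ∈ xs × P k) →
             ∃[ k ] (k ∈ xs × P k × k ≢ z)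
      pick (a ∷ b ∷ _) ((a≢b ∷ _) ∷ _) (s≤s (s≤s _)) sound with a ≟ z
      ... | no a≢z = a , proj₁ (sound (here refl)) , proj₂ (sound (here refl)) , a≢z
      ... | yes refl = b , proj₁ (sound (there (here refl))) , proj₂ (sound (there (here refl))) , a≢b ∘′ sym

  subsingleton⇒length≤1 : ∀ {P : Pred A 0ℓ} xs → Unique xs → (∀ {x} → x ∈ xs → P x) → Subsingleton P →
                          length xs ≤ 1
  subsingleton⇒length≤1 [] _ _ _ = z≤n
  subsingleton⇒length≤1 (_ ∷ []) _ _ _ = ≤-refl
  subsingleton⇒length≤1 (_ ∷ _ ∷ _) ((x≢y ∷ _) ∷ _) p unique =
    contradiction (unique (p (here refl)) (p (there (here refl)))) x≢y

  private
    drop-subsingleton : ∀ {P R : Pred A 0ℓ} xs → Unique xs → (∀ {x} → x ∈ xs → P x ⊎ R x) → Subsingleton P →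
                        ∃[ ys ] (Unique ys × (∀ {y} → y ∈ ys → R y) × ys ⊆ xs × length xs ≤ suc (length ys))
    drop-subsingleton [] _ _ _ = [] , [] , (λ ()) , (λ ()) , z≤n
    drop-subsingleton (x ∷ xs) (x∉xs ∷ u) cover unique with cover (here refl)
    ... | inj₁ px = xs , u , onlyR , there , ≤-refl
      where onlyR : ∀ {y} → y ∈ xs → _
            onlyR y∈xs with cover (there y∈xs)
            ... | inj₂ ry = ry
            ... | inj₁ py = contradiction (unique px py) (All-lookup x∉xs y∈xs)
    ... | inj₂ rx with drop-subsingleton xs u (cover ∘′ there) unique
    ...   | ys , uys , onlyR , ys⊆xs , len =
            x ∷ ys , (fresh ys ys⊆xs ∷ uys) , (λ { (here refl) → rx ; (there y∈) → onlyR y∈ }) ,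
            (λ { (here refl) → here refl ; (there y∈) → there (ys⊆xs y∈) }) , s≤s len
      where fresh : ∀ zs → zs ⊆ xs → All (x ≢_) zs
            fresh [] _ = []
            fresh (z ∷ zs) zs⊆xs = All-lookup x∉xs (zs⊆xs (here refl)) ∷ fresh zs (zs⊆xs ∘′ there)

  cover₃⇒length≤3 : ∀ {P Q R : Pred A 0ℓ} xs → Unique xs → (∀ {x} → x ∈ xs → P x ⊎ Q x ⊎ R x) →
                    Subsingleton P → Subsingleton Q → Subsingleton R → length xs ≤ 3
  cover₃⇒length≤3 xs u cover sP sQ sR with drop-subsingleton xs u cover sP
  ... | ys , uys , coverQR , _ , len with drop-subsingleton ys uys coverQR sQ
  ...   | zs , uzs , onlyR , _ , len′ = ≤-trans len (s≤s (≤-trans len′ (s≤s (subsingleton⇒length≤1 zs uzs onlyR sR))))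

module _ {A : Set} (_≟_ : DecidableEquality A) where
  open DecMembership _≟_ using (_∈?_)

  -- |A| + |B ∖ A| and |B| + |A ∖ B| both count A ∪ B.
  length-filter-union : ∀ {P Q : Pred A 0ℓ} (P? : Decidable P) (Q? : Decidable Q) xs →
    length (filter P? xs) + length (filter (λ p → ¬? (p ∈? filter P? xs)) (filter Q? xs))
    ≡ length (filter Q? xs) + length (filter (λ p → ¬? (p ∈? filter Q? xs)) (filter P? xs))
  length-filter-union P? Q? xs = begin
      length (filter P? xs) + ∣B∖A∣          ≡⟨ cong₂ _+_ (length-filter-split P? Q? xs) B∖A-count ⟩
      (∣A∩B∣ + ∣P∖Q∣) + ∣Q∖P∣                 ≡⟨ +-assoc ∣A∩B∣ ∣P∖Q∣ ∣Q∖P∣ ⟩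
      ∣A∩B∣ + (∣P∖Q∣ + ∣Q∖P∣)                 ≡⟨ cong₂ _+_ ∩-comm (+-comm ∣P∖Q∣ ∣Q∖P∣) ⟩
      ∣B∩A∣ + (∣Q∖P∣ + ∣P∖Q∣)                 ≡⟨ +-assoc ∣B∩A∣ ∣Q∖P∣ ∣P∖Q∣ ⟨
      (∣B∩A∣ + ∣Q∖P∣) + ∣P∖Q∣                 ≡⟨ cong₂ _+_ (length-filter-split Q? P? xs) A∖B-count ⟨
      length (filter Q? xs) + ∣A∖B∣          ∎
    where
      open ≡-Reasoning
      ∣A∩B∣ = length (filter (λ x → P? x ×-dec Q? x) xs)
      ∣B∩A∣ = length (filter (λ x → Q? x ×-dec P? x) xs)
      ∣P∖Q∣ = length (filter (λ x → P? x ×-dec ¬? (Q? x)) xs)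
      ∣Q∖P∣ = length (filter (λ x → Q? x ×-dec ¬? (P? x)) xs)
      ∣A∖B∣ = length (filter (λ p → ¬? (p ∈? filter Q? xs)) (filter P? xs))
      ∣B∖A∣ = length (filter (λ p → ¬? (p ∈? filter P? xs)) (filter Q? xs))
      ∩-comm : ∣A∩B∣ ≡ ∣B∩A∣
      ∩-comm = length-filter-cong _ _ xs (λ _ (p , q) → q , p) (λ _ (q , p) → p , q)
      difference-count : ∀ {P Q : Pred A 0ℓ} (P? : Decidable P) (Q? : Decidable Q) →
        length (filter (λ p → ¬? (p ∈? filter Q? xs)) (filter P? xs)) ≡ length (filter (λ x → P? x ×-dec ¬? (Q? x)) xs)
      difference-count P? Q? = trans (length-filter-filter P? (λ p → ¬? (p ∈? filter Q? xs)) xs)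
        (length-filter-cong _ _ xs (λ x∈ (p , ∉B) → p , λ q → ∉B (∈-filter⁺ Q? x∈ q))
                                   (λ _ (p , ¬q) → p , λ ∈B → ¬q (proj₂ (∈-filter⁻ Q? {xs = xs} ∈B))))
      A∖B-count = difference-count P? Q?
      B∖A-count = difference-count Q? P?

¬2≤1 : ¬ (2 ≤ 1)
¬2≤1 (s≤s ())

≥2⇒≢1 : ∀ {x} → 2 ≤ x → x ≢ 1
≥2⇒≢1 2≤x refl = ¬2≤1 2≤x

least-witness : ∀ {Q : Pred ℕ 0ℓ} → Decidable Q → ∀ {n} → Q n →
                ∃[ k ] (k ≤ n × Q k × (∀ {k′} → k′ < k → ¬ Q k′))
least-witness {Q} Q? {n} qn with search (suc n)
  where
    search : ∀ b → (∀ {k} → k < b → ¬ Q k) ⊎ ∃[ k ] (k < b × Q k × (∀ {k′} → k′ < k → ¬ Q k′))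
    search zero = inj₁ λ ()
    search (suc b) with search b
    ... | inj₂ (k , k<b , qk , least) = inj₂ (k , m≤n⇒m≤1+n k<b , qk , least)
    ... | inj₁ none with Q? b
    ...   | yes qb = inj₂ (b , ≤-refl , qb , none)
    ...   | no ¬qb = inj₁ λ k<1+b → [ none , (λ { refl → ¬qb }) ]′ (m≤n⇒m<n∨m≡n (≤-pred k<1+b))
... | inj₁ none = contradiction qn (none ≤-refl)
... | inj₂ (k , s≤s k≤n , qk , least) = k , k≤n , qk , least

every⊎some : ∀ {A : Set} {P Q : Pred A 0ℓ} (xs : List A) → (∀ {x} → x ∈ xs → P x ⊎ Q x) →
             (∀ {x} → x ∈ xs → P x) ⊎ ∃[ x ] (x ∈ xs × Q x)
every⊎some [] _ = inj₁ λ ()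
every⊎some (x ∷ xs) cover with cover (here refl) | every⊎some xs (cover ∘′ there)
... | inj₂ qx | _                  = inj₂ (x , here refl , qx)
... | inj₁ _  | inj₂ (y , y∈ , qy) = inj₂ (y , there y∈ , qy)
... | inj₁ px | inj₁ every         = inj₁ λ { (here refl) → px ; (there y∈) → every y∈ }

length-filter-applyUpTo-suc : ∀ {P : Pred ℕ 0ℓ} (P? : Decidable P) (f : ℕ → ℕ) n →
  length (filter P? (applyUpTo (λ x → suc (f x)) n)) ≡ length (filter (λ x → P? (suc x)) (applyUpTo f n))
length-filter-applyUpTo-suc P? f zero = refl
length-filter-applyUpTo-suc P? f (suc n) with P? (suc (f 0))
... | yes _ = cong suc (length-filter-applyUpTo-suc P? (λ x → f (suc x)) n)
... | no _  = length-filter-applyUpTo-suc P? (λ x → f (suc x)) n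

module _ {A : Set} where

  take-drop-suc : ∀ k n (W : List A) {x w} → take (suc n) (drop k W) ≡ x ∷ w → take n (drop (suc k) W) ≡ w
  take-drop-suc zero    n (y ∷ W) refl = refl
  take-drop-suc (suc k) n (y ∷ W) e    = take-drop-suc k n W e
  take-drop-suc zero    n []      ()
  take-drop-suc (suc k) n []      ()

  take-take-≤ : ∀ {a b} (xs : List A) → a ≤ b → take a (take b xs) ≡ take a xs
  take-take-≤ {a} {b} xs a≤b = trans (take-take a b xs) (cong (λ k → take k xs) (m≤n⇒m⊓n≡m a≤b))

  length-take-≤ : ∀ {a} (xs : List A) → a ≤ length xs → length (take a xs) ≡ a
  length-take-≤ {a} xs a≤ = trans (length-take a xs) (m≤n⇒m⊓n≡m a≤)

  factor : List A → ℕ → ℕ → List A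
  factor W o l = take l (drop o W)

  length-factor : ∀ (W : List A) o l → o + l ≤ length W → length (factor W o l) ≡ l
  length-factor W o l fits = length-take-≤ (drop o W)
    (subst (l ≤_) (sym (length-drop o W)) (m+n≤o⇒m≤o∸n l (subst (_≤ length W) (+-comm o l) fits)))

  drop-∷ : ∀ (W : List A) o → o < length W → ∃[ y ] (drop o W ≡ y ∷ drop (suc o) W)
  drop-∷ (x ∷ W) zero    _       = x , refl
  drop-∷ (x ∷ W) (suc o) (s≤s o<) = drop-∷ W o o<

  drop-take : ∀ k L (Y : List A) → drop k (take L Y) ≡ take (L ∸ k) (drop k Y)
  drop-take zero    L       Y       = refl
  drop-take (suc k) zero    Y       = refl
  drop-take (suc k) (suc L) []      = sym (take-[] (L ∸ k))
  drop-take (suc k) (suc L) (y ∷ Y) = drop-take k L Y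

  take-length-++ : ∀ (V R : List A) → take (length V) (V ++ R) ≡ V
  take-length-++ []      R = refl
  take-length-++ (x ∷ V) R = cong (x ∷_) (take-length-++ V R)

  drop-replicate-++ : ∀ (z : A) k Q → drop k (replicate k z ++ Q) ≡ Q
  drop-replicate-++ z zero    Q = refl
  drop-replicate-++ z (suc k) Q = drop-replicate-++ z k Q

  fromList-of-length : ∀ {n} (xs : List A) → length xs ≡ n → ∃[ T ] (toList {n = n} T ≡ xs)
  fromList-of-length xs refl = fromList xs , toList∘fromList xs

module _ {σ : ℕ} where

  Matches : Str σ → Str σ → ℕ → Set
  Matches w W k = take (length w) (drop k W) ≡ w

  occursAt? : (w W : Str σ) → Decidable (Matches w W)
  occursAt? w W k = ≡-dec _≟F_ (take (length w) (drop k W)) w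

  OccursAt : Str σ → Str σ → ℕ → Set
  OccursAt w W k = k ≤ length W × Matches w W k

  occ-≥ : ∀ {w W} {ks : List ℕ} → Unique ks → (∀ {k} → k ∈ ks → OccursAt w W k) → length ks ≤ occ w W
  occ-≥ {w} {W} u occurs = unique⊆⇒length≤ u
    (λ k∈ks → ∈-filter⁺ (occursAt? w W) (∈-upTo⁺ (s≤s (proj₁ (occurs k∈ks)))) (proj₂ (occurs k∈ks)))

  occ≥1 : ∀ {w W a} → OccursAt w W a → 1 ≤ occ w W
  occ≥1 {w} {W} {a} oa = occ-≥ {w} {W} {a ∷ []} ([] ∷ []) λ { (here refl) → oa }

  occ≥2 : ∀ {w W a b} → OccursAt w W a → OccursAt w W b → a ≢ b → 2 ≤ occ w W
  occ≥2 {w} {W} {a} {b} oa ob a≢b = occ-≥ {w} {W} {a ∷ b ∷ []} ((a≢b ∷ []) ∷ [] ∷ [])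
    λ { (here refl) → oa ; (there (here refl)) → ob }

  occ≥3 : ∀ {w W a b c} → OccursAt w W a → OccursAt w W b → OccursAt w W c →
          a ≢ b → a ≢ c → b ≢ c → 3 ≤ occ w W
  occ≥3 {w} {W} {a} {b} {c} oa ob oc a≢b a≢c b≢c = occ-≥ {w} {W} {a ∷ b ∷ c ∷ []}
    ((a≢b ∷ a≢c ∷ []) ∷ (b≢c ∷ []) ∷ [] ∷ [])
    λ { (here refl) → oa ; (there (here refl)) → ob ; (there (there (here refl))) → oc }

  occ≡1⇒same-position : ∀ {w W a b} → occ w W ≡ 1 → OccursAt w W a → OccursAt w W b → a ≡ b
  occ≡1⇒same-position {w} {W} {a} {b} once oa ob with a ≟ b
  ... | yes a≡b = a≡b
  ... | no a≢b  = contradiction (subst (2 ≤_) once (occ≥2 {w} {W} oa ob a≢b)) ¬2≤1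

  occ≡2⇒one-of : ∀ {w W a b c} → occ w W ≡ 2 → OccursAt w W a → OccursAt w W b → OccursAt w W c →
                 a ≢ b → c ≡ a ⊎ c ≡ b
  occ≡2⇒one-of {w} {W} {a} {b} {c} twice oa ob oc a≢b with c ≟ a | c ≟ b
  ... | yes c≡a | _       = inj₁ c≡a
  ... | no _    | yes c≡b = inj₂ c≡b
  ... | no c≢a  | no c≢b  = contradiction (subst (3 ≤_) twice (occ≥3 {w} {W} oa ob oc a≢b (c≢a ∘′ sym) (c≢b ∘′ sym)))
                                          λ { (s≤s (s≤s ())) }

  occ≡2⇒later-position-unique : ∀ {w W p q} → occ w W ≡ 2 → OccursAt w W 0 →
                                OccursAt w W (suc p) → OccursAt w W (suc q) → q ≡ p
  occ≡2⇒later-position-unique twice o₀ op oq with occ≡2⇒one-of twice o₀ op oq (λ ())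
  ... | inj₂ q≡p = suc-injective q≡p

  occ≥2⇒position-≢ : ∀ {w W} → 2 ≤ occ w W → ∀ z → ∃[ k ] (OccursAt w W k × k ≢ z)
  occ≥2⇒position-≢ {w} {W} twice z with filter-≥2⇒witness-≢ _≟_ (occursAt? w W) (upTo⁺ (suc (length W))) twice z
  ... | k , k∈ , occurs , k≢z = k , (≤-pred (∈-upTo⁻ k∈) , occurs) , k≢z

  prefix-take : ∀ (v X : Str σ) a → take (length v) X ≡ v → take (length (take a v)) X ≡ take a v
  prefix-take v X a e rewrite length-take a v = trans (sym (take-take a (length v) X)) (cong (take a) e)

  occursAt-take : ∀ {v W k} a → OccursAt v W k → OccursAt (take a v) W k
  occursAt-take {v} {W} {k} a (k≤ , e) = k≤ , prefix-take v (drop k W) a e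

  occ-take-≥ : ∀ v W a → occ v W ≤ occ (take a v) W
  occ-take-≥ v W a = length-filter-mono (occursAt? v W) (occursAt? (take a v) W)
                       (λ {k} e → prefix-take v (drop k W) a e) (upTo (suc (length W)))

  occursAt⇒fits : ∀ {w W k} → OccursAt w W k → k + length w ≤ length W
  occursAt⇒fits {w} {W} {k} (k≤ , e) = begin
    k + length w                            ≡⟨ cong (λ x → k + length x) e ⟨
    k + length (take (length w) (drop k W)) ≡⟨ cong (λ x → k + x) (length-take (length w) (drop k W)) ⟩
    k + (length w ⊓ length (drop k W))      ≤⟨ +-monoʳ-≤ k (m⊓n≤n (length w) _) ⟩
    k + length (drop k W)                   ≡⟨ cong (λ x → k + x) (length-drop k W) ⟩
    k + (length W ∸ k)                      ≡⟨ m+[n∸m]≡n k≤ ⟩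
    length W                                ∎
    where open ≤-Reasoning

  occursAt-factor : ∀ {W : Str σ} o l → o + l ≤ length W → OccursAt (factor W o l) W o
  occursAt-factor {W} o l fits =
    ≤-trans (m≤m+n o l) fits , cong (λ k → take k (drop o W)) (length-factor W o l fits)

  occursAt-tail : ∀ {x w W k} → OccursAt (x ∷ w) W k → OccursAt w W (suc k)
  occursAt-tail {x} {w} {W} {k} o@(_ , e) =
    ≤-trans (s≤s (m≤m+n k (length w))) (subst (_≤ length W) (+-suc k (length w)) (occursAt⇒fits o)) ,
    take-drop-suc k (length w) W e

  occ-∷-prefix : ∀ w (c : Fin σ) V → take (length w) (c ∷ V) ≡ w → occ w (c ∷ V) ≡ suc (occ w V)
  occ-∷-prefix w c V prefix =
    trans (cong length (filter-accept (occursAt? w (c ∷ V)) {x = 0} {xs = applyUpTo suc (suc (length V))} prefix))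
    (cong suc (length-filter-applyUpTo-suc (occursAt? w (c ∷ V)) (λ x → x) (suc (length V))))

  occ-∷-¬prefix : ∀ w (c : Fin σ) V → take (length w) (c ∷ V) ≢ w → occ w (c ∷ V) ≡ occ w V
  occ-∷-¬prefix w c V ¬prefix =
    trans (cong length (filter-reject (occursAt? w (c ∷ V)) {x = 0} {xs = applyUpTo suc (suc (length V))} ¬prefix))
    (length-filter-applyUpTo-suc (occursAt? w (c ∷ V)) (λ x → x) (suc (length V)))

  occ-≤-occ-∷ : ∀ w (c : Fin σ) V → occ w V ≤ occ w (c ∷ V)
  occ-≤-occ-∷ w c V = by-cases (occursAt? w (c ∷ V) 0)
    where by-cases : Dec (take (length w) (c ∷ V) ≡ w) → occ w V ≤ occ w (c ∷ V)
          by-cases (yes prefix) = ≤-trans (n≤1+n _) (≤-reflexive (sym (occ-∷-prefix w c V prefix)))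
          by-cases (no ¬prefix) = ≤-reflexive (sym (occ-∷-¬prefix w c V ¬prefix))

  occ-∷-≤-suc : ∀ w (c : Fin σ) V → occ w (c ∷ V) ≤ suc (occ w V)
  occ-∷-≤-suc w c V = by-cases (occursAt? w (c ∷ V) 0)
    where by-cases : Dec (take (length w) (c ∷ V) ≡ w) → occ w (c ∷ V) ≤ suc (occ w V)
          by-cases (yes prefix) = ≤-reflexive (occ-∷-prefix w c V prefix)
          by-cases (no ¬prefix) = ≤-trans (≤-reflexive (occ-∷-¬prefix w c V ¬prefix)) (n≤1+n _)

-- Minimal unique substrings in offset/length coordinates

-- W[o .. o+d] (0-based) is a minimal unique substring of W.
MinUnique : ∀ {σ} → Str σ → ℕ → ℕ → Set
MinUnique W o d = occ (factor W o (suc d)) W ≡ 1 × 2 ≤ occ (factor W (suc o) d) W × 2 ≤ occ (factor W o d) W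

MinUnique-no-longer : ∀ {σ} {W : Str σ} {o d d′} → d < d′ → MinUnique W o d → MinUnique W o d′ → ⊥
MinUnique-no-longer {W = W} {o} {d} {d′} d<d′ (once , _) (_ , _ , repeats) = ¬2≤1 (begin
  2                                         ≤⟨ repeats ⟩
  occ (factor W o d′) W                     ≤⟨ occ-take-≥ (factor W o d′) W (suc d) ⟩
  occ (take (suc d) (factor W o d′)) W      ≡⟨ cong (λ w → occ w W) (take-take-≤ (drop o W) d<d′) ⟩
  occ (factor W o (suc d)) W                ≡⟨ once ⟩
  1                                         ∎)
  where open ≤-Reasoning

MinUnique-same-start : ∀ {σ} {W : Str σ} {o d d′} → MinUnique W o d → MinUnique W o d′ → d ≡ d′
MinUnique-same-start {d = d} {d′} mu mu′ with <-cmp d d′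
... | tri< d<d′ _ _ = ⊥-elim (MinUnique-no-longer d<d′ mu mu′)
... | tri≈ _ d≡d′ _ = d≡d′
... | tri> _ _ d>d′ = ⊥-elim (MinUnique-no-longer d>d′ mu′ mu)

-- Prepending one letter c to a window V

module Prepend {σ : ℕ} (c : Fin σ) (V : Str σ) where

  cV : Str σ
  cV = c ∷ V

  m : ℕ
  m = length V

  Gain : ℕ → ℕ → Set
  Gain o d = o + suc d ≤ m × MinUnique cV (suc o) d × ¬ MinUnique V o d

  Loss : ℕ → ℕ → Set
  Loss o d = o + suc d ≤ m × MinUnique V o d × ¬ MinUnique cV (suc o) d

  occursAt-∷⁻ : ∀ {w k} → OccursAt w cV (suc k) → OccursAt w V k
  occursAt-∷⁻ (s≤s k≤m , matches) = k≤m , matches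

  occursAt-∷⁺ : ∀ {w k} → OccursAt w V k → OccursAt w cV (suc k)
  occursAt-∷⁺ (k≤m , matches) = s≤s k≤m , matches

  occursAt-prefix : ∀ {w} e → length w ≡ e → take e cV ≡ w → OccursAt w cV 0
  occursAt-prefix {w} e len prefix = z≤n , trans (cong (λ k → take k cV) len) prefix

  occursAt-factor-V : ∀ o l → o + l ≤ m → OccursAt (factor V o l) cV (suc o)
  occursAt-factor-V o l fits = occursAt-∷⁺ (occursAt-factor {W = V} o l fits)

  fits-init : ∀ {o d} → o + suc d ≤ m → o + d ≤ m
  fits-init {o} fits = ≤-trans (+-monoʳ-≤ o (n≤1+n _)) fits

  fits-tail : ∀ {o d} → o + suc d ≤ m → suc o + d ≤ m
  fits-tail {o} {d} fits = subst (_≤ m) (+-suc o d) fits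

  repeating-in-cV-only⇒prefix : ∀ w → 2 ≤ occ w cV → occ w V ≤ 1 → 1 ≤ occ w V →
                                 take (length w) cV ≡ w × occ w cV ≡ 2
  repeating-in-cV-only⇒prefix w repeats ≤1 ≥1 = by-cases (occursAt? w cV 0)
    where
      by-cases : Dec (take (length w) cV ≡ w) → take (length w) cV ≡ w × occ w cV ≡ 2
      by-cases (yes prefix) = prefix , trans (occ-∷-prefix w c V prefix) (cong suc (≤-antisym ≤1 ≥1))
      by-cases (no ¬prefix) = ⊥-elim (¬2≤1 (≤-trans repeats (≤-trans (≤-reflexive (occ-∷-¬prefix w c V ¬prefix)) ≤1)))

  InitGain : ℕ → ℕ → Set
  InitGain o d = Gain o d × occ (factor V o d) cV ≡ 2 × take d cV ≡ factor V o d

  TailGain : ℕ → ℕ → Set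
  TailGain o d = Gain o d × occ (factor V (suc o) d) cV ≡ 2 × take d cV ≡ factor V (suc o) d

  -- The unique factor is still unique in V, so one of its two shortenings repeats
  -- in cV but not in V: it gained its second occurrence as a prefix of cV.
  Gain⇒InitGain⊎TailGain : ∀ {o d} → Gain o d → InitGain o d ⊎ TailGain o d
  Gain⇒InitGain⊎TailGain {o} {d} gain@(fits , (once , tail-repeats , init-repeats) , ¬mu)
    with 2 ≤? occ (factor V (suc o) d) V | 2 ≤? occ (factor V o d) V
  ... | yes tail-repeats-V | yes init-repeats-V = ⊥-elim (¬mu (once-V , tail-repeats-V , init-repeats-V))
    where once-V = ≤-antisym (≤-trans (occ-≤-occ-∷ (factor V o (suc d)) c V) (≤-reflexive once))
                             (occ≥1 (occursAt-factor {W = V} o (suc d) fits))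
  ... | yes _ | no init-once
    with repeating-in-cV-only⇒prefix (factor V o d) init-repeats (≤-pred (≰⇒> init-once))
                                     (occ≥1 (occursAt-factor {W = V} o d (fits-init fits)))
  ...   | prefix , twice = inj₁ (gain , twice ,
          trans (cong (λ k → take k cV) (sym (length-factor V o d (fits-init fits)))) prefix)
  Gain⇒InitGain⊎TailGain {o} {d} gain@(fits , (_ , tail-repeats , _) , _) | no tail-once | _
    with repeating-in-cV-only⇒prefix (factor V (suc o) d) tail-repeats (≤-pred (≰⇒> tail-once))
                                     (occ≥1 (occursAt-factor {W = V} (suc o) d (fits-tail fits)))
  ... | prefix , twice = inj₂ (gain , twice ,
        trans (cong (λ k → take k cV) (sym (length-factor V (suc o) d (fits-tail fits)))) prefix)

  private
    subsingleton-by-length : {G : ℕ → ℕ → Set} →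
      (∀ {o d o′ d′} → G o d → G o′ d′ → d ≤ d′ → o′ ≡ o) →
      (∀ {o d d′} → G o d → G o d′ → d < d′ → ⊥) →
      ∀ {o d o′ d′} → G o d → G o′ d′ → o ≡ o′ × d ≡ d′
    subsingleton-by-length same-start no-longer {d = d} {d′ = d′} g g′ with <-cmp d d′
    ... | tri< d<d′ _ _ with same-start g g′ (<⇒≤ d<d′)
    ...   | refl = ⊥-elim (no-longer g g′ d<d′)
    subsingleton-by-length same-start no-longer g g′ | tri≈ _ refl _ with same-start g g′ ≤-refl
    ...   | refl = refl , refl
    subsingleton-by-length same-start no-longer g g′ | tri> _ _ d>d′ with same-start g′ g (<⇒≤ d>d′)
    ...   | refl = ⊥-elim (no-longer g′ g d>d′)

  InitGain-same-start : ∀ {o d o′ d′} → InitGain o d → InitGain o′ d′ → d ≤ d′ → o′ ≡ o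
  InitGain-same-start {o} {d} {o′} {d′} ((fits , _) , twice , prefix) ((fits′ , _) , _ , prefix′) d≤d′ =
    occ≡2⇒later-position-unique twice (occursAt-prefix d (length-factor V o d (fits-init fits)) prefix)
      (occursAt-factor-V o d (fits-init fits))
      (subst (λ w → OccursAt w cV (suc o′)) (trans (cong (take d) (sym prefix′)) (trans (take-take-≤ cV d≤d′) prefix))
             (occursAt-take {W = cV} d (occursAt-factor-V o′ d′ (fits-init fits′))))

  -- The unique factor V[o .. o+d] would be a prefix of cV, occurring at 0 and at o+1.
  InitGain-no-longer : ∀ {o d d′} → InitGain o d → InitGain o d′ → d < d′ → ⊥
  InitGain-no-longer {o} {d} {d′} ((fits , (once , _) , _) , _) ((fits′ , _) , _ , prefix′) d<d′ =
    ¬2≤1 (subst (2 ≤_) once (occ≥2 at-0 (occursAt-factor-V o (suc d) fits) (λ ())))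
    where
      unique-is-prefix : take (suc d) cV ≡ factor V o (suc d)
      unique-is-prefix = trans (sym (take-take-≤ cV d<d′))
        (trans (cong (take (suc d)) prefix′) (take-take-≤ (drop o V) d<d′))
      at-0 : OccursAt (factor V o (suc d)) cV 0
      at-0 = occursAt-prefix (suc d) (length-factor V o (suc d) fits) unique-is-prefix

  InitGain-unique : ∀ {o d o′ d′} → InitGain o d → InitGain o′ d′ → o ≡ o′ × d ≡ d′
  InitGain-unique = subsingleton-by-length InitGain-same-start InitGain-no-longer

  TailGain-same-start : ∀ {o d o′ d′} → TailGain o d → TailGain o′ d′ → d ≤ d′ → o′ ≡ o
  TailGain-same-start {o} {d} {o′} {d′} ((fits , _) , twice , prefix) ((fits′ , _) , _ , prefix′) d≤d′ =
    suc-injective (occ≡2⇒later-position-unique twice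
      (occursAt-prefix d (length-factor V (suc o) d (fits-tail fits)) prefix)
      (occursAt-factor-V (suc o) d (fits-tail fits))
      (subst (λ w → OccursAt w cV (suc (suc o′))) (trans (cong (take d) (sym prefix′)) (trans (take-take-≤ cV d≤d′) prefix))
             (occursAt-take {W = cV} d (occursAt-factor-V (suc o′) d′ (fits-tail fits′)))))

  -- The repeating init V[o .. o+d′-1] of the longer gain has an occurrence at some
  -- k ≠ o+1 in cV, which yields a third occurrence of the twice-occurring tail.
  TailGain-no-longer : ∀ {o d d′} → TailGain o d → TailGain o d′ → d < d′ → ⊥
  TailGain-no-longer {o} {d} {suc e} ((fits , _) , twice , prefix) ((fits′ , (_ , _ , init-repeats) , _) , _) (s≤s d≤e)
    with occ≥2⇒position-≢ init-repeats (suc o)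
       | drop-∷ V o (≤-trans (s≤s (m≤m+n o (suc e))) (subst (_≤ m) (+-suc o (suc e)) fits′))
  ... | k , at-k , k≢1+o | y , drop-o = k≢1+o (occ≡2⇒later-position-unique twice
        (occursAt-prefix d (length-factor V (suc o) d (fits-tail fits)) prefix)
        (occursAt-factor-V (suc o) d (fits-tail fits)) at-1+k)
    where
      at-1+k : OccursAt (factor V (suc o) d) cV (suc k)
      at-1+k = subst (λ w → OccursAt w cV (suc k)) (take-take-≤ (drop (suc o) V) d≤e)
        (occursAt-take {W = cV} d (occursAt-tail {W = cV} (subst (λ w → OccursAt w cV k) (cong (take (suc e)) drop-o) at-k)))

  TailGain-unique : ∀ {o d o′ d′} → TailGain o d → TailGain o′ d′ → o ≡ o′ × d ≡ d′
  TailGain-unique = subsingleton-by-length TailGain-same-start TailGain-no-longer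

  -- A lost MUS of V keeps its repeats in cV, so it must gain an occurrence at the front.
  Loss⇒prefix : ∀ {o d} → Loss o d → take (suc d) cV ≡ factor V o (suc d)
  Loss⇒prefix {o} {d} (fits , (once , tail-repeats , init-repeats) , ¬mu) = by-cases (occursAt? (factor V o (suc d)) cV 0)
    where
      by-cases : Dec (take (length (factor V o (suc d))) cV ≡ factor V o (suc d)) → take (suc d) cV ≡ factor V o (suc d)
      by-cases (yes prefix) = trans (cong (λ k → take k cV) (sym (length-factor V o (suc d) fits))) prefix
      by-cases (no ¬prefix) = ⊥-elim (¬mu (trans (occ-∷-¬prefix _ c V ¬prefix) once ,
        ≤-trans tail-repeats (occ-≤-occ-∷ (factor V (suc o) d) c V) , ≤-trans init-repeats (occ-≤-occ-∷ (factor V o d) c V)))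

  Loss-no-longer : ∀ {o d o′ d′} → Loss o d → Loss o′ d′ → d < d′ → ⊥
  Loss-no-longer {o} {d} {o′} {d′} loss@(_ , (once , _) , _) loss′@(_ , (_ , _ , init-repeats′) , _) d<d′ =
    ¬2≤1 (≤-trans init-repeats′ (≤-trans (occ-take-≥ (factor V o′ d′) V (suc d))
      (≤-reflexive (trans (cong (λ w → occ w V) shorter-is-prefix) once))))
    where
      X = drop o′ V
      shorter-is-prefix : take (suc d) (factor V o′ d′) ≡ factor V o (suc d)
      shorter-is-prefix = begin
        take (suc d) (take d′ X)               ≡⟨ take-take-≤ X d<d′ ⟩
        take (suc d) X                         ≡⟨ take-take-≤ X (s≤s (<⇒≤ d<d′)) ⟨
        take (suc d) (take (suc d′) X)         ≡⟨ cong (take (suc d)) (Loss⇒prefix loss′) ⟨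
        take (suc d) (take (suc d′) cV)        ≡⟨ take-take-≤ cV (s≤s (<⇒≤ d<d′)) ⟩
        take (suc d) cV                        ≡⟨ Loss⇒prefix loss ⟩
        factor V o (suc d)                     ∎
        where open ≡-Reasoning

  Loss-same-start : ∀ {o d o′ d′} → Loss o d → Loss o′ d′ → d ≤ d′ → o′ ≡ o
  Loss-same-start {o} {d} {o′} {d′} loss loss′ d≤d′ with m≤n⇒m<n∨m≡n d≤d′
  ... | inj₁ d<d′ = ⊥-elim (Loss-no-longer loss loss′ d<d′)
  ... | inj₂ refl = occ≡1⇒same-position (proj₁ (proj₁ (proj₂ loss)))
    (subst (λ w → OccursAt w V o′) (trans (sym (Loss⇒prefix loss′)) (Loss⇒prefix loss))
           (occursAt-factor {W = V} o′ (suc d) (proj₁ loss′)))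
    (occursAt-factor {W = V} o (suc d) (proj₁ loss))

  Loss-unique : ∀ {o d o′ d′} → Loss o d → Loss o′ d′ → o ≡ o′ × d ≡ d′
  Loss-unique = subsingleton-by-length Loss-same-start Loss-no-longer

  occ-ε≥3 : 1 ≤ m → 3 ≤ occ [] cV
  occ-ε≥3 1≤m = occ≥3 {w = []} {W = cV} {a = 0} {b = 1} {c = 2}
    (z≤n , refl) (s≤s z≤n , refl) (s≤s 1≤m , refl) (λ ()) (λ ()) (λ ())

  -- The shortest prefix of cV occurring at most twice in cV is a MUS of V lost in cV.
  twice-prefix⇒Loss : ∀ e q → 1 ≤ m → e ≤ m → occ (take e cV) cV ≡ 2 → OccursAt (take e cV) cV (suc q) →
                      ∃[ d ] Loss q d
  twice-prefix⇒Loss e q 1≤m e≤m twice at-1+q with least-witness (λ k → occ (take k cV) cV ≤? 2) (≤-reflexive twice)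
  ... | zero , _ , ≤2 , _ = ⊥-elim (¬2≤1 (≤-pred (≤-trans (occ-ε≥3 1≤m) ≤2)))
  ... | suc d , 1+d≤e , ≤2 , shorter-more =
        d , fits , (once , tail-repeats , init-repeats) ,
        λ (once′ , _) → ≥2⇒≢1 (≤-reflexive (trans (sym v-twice) (cong (λ w → occ w cV) (sym v≡factor)))) once′
    where
      v = take (suc d) cV
      length-v : length v ≡ suc d
      length-v = length-take-≤ cV (≤-trans 1+d≤e (m≤n⇒m≤1+n e≤m))
      v-twice : occ v cV ≡ 2
      v-twice = ≤-antisym ≤2 (begin
        2                         ≡⟨ twice ⟨
        occ (take e cV) cV        ≤⟨ occ-take-≥ (take e cV) cV (suc d) ⟩
        occ (take (suc d) (take e cV)) cV ≡⟨ cong (λ w → occ w cV) (take-take-≤ cV 1+d≤e) ⟩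
        occ v cV                  ∎)
        where open ≤-Reasoning
      v-at-0 : OccursAt v cV 0
      v-at-0 = occursAt-prefix (suc d) length-v refl
      v-at-1+q : OccursAt v cV (suc q)
      v-at-1+q = subst (λ w → OccursAt w cV (suc q)) (take-take-≤ cV 1+d≤e) (occursAt-take {W = cV} (suc d) at-1+q)
      fits : q + suc d ≤ m
      fits = ≤-pred (subst (λ l → suc q + l ≤ suc m) length-v (occursAt⇒fits {W = cV} v-at-1+q))
      v≡factor : factor V q (suc d) ≡ v
      v≡factor = trans (cong (λ k → take k (drop q V)) (sym length-v)) (proj₂ v-at-1+q)
      once : occ (factor V q (suc d)) V ≡ 1
      once = trans (cong (λ w → occ w V) v≡factor)
                   (suc-injective (trans (sym (occ-∷-prefix v c V (cong (λ k → take k cV) length-v))) v-twice))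
      tail-at-1+q : OccursAt (take d V) V (suc q)
      tail-at-1+q = occursAt-∷⁻ (occursAt-tail {W = cV} v-at-1+q)
      tail-repeats : 2 ≤ occ (factor V (suc q) d) V
      tail-repeats = subst (λ w → 2 ≤ occ w V)
        (sym (trans (cong (λ k → take k (drop (suc q) V)) (sym (length-take-≤ V (≤-trans (n≤1+n d) (≤-trans 1+d≤e e≤m)))))
                    (proj₂ tail-at-1+q)))
        (occ≥2 (occursAt-∷⁻ (occursAt-tail {W = cV} v-at-0)) tail-at-1+q (λ ()))
      init≡prefix : factor V q d ≡ take d cV
      init≡prefix = trans (sym (take-take-≤ (drop q V) (n≤1+n d)))
                          (trans (cong (take d) v≡factor) (take-take-≤ cV (n≤1+n d)))
      init-repeats : 2 ≤ occ (factor V q d) V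
      init-repeats = subst (λ w → 2 ≤ occ w V) (sym init≡prefix)
        (≤-pred (≤-trans (≰⇒> (shorter-more ≤-refl)) (occ-∷-≤-suc (take d cV) c V)))

  Gain⇒Loss : ∀ {o d} → Gain o d → ∃[ o′ ] ∃[ d′ ] Loss o′ d′
  Gain⇒Loss {o} {d} gain@(fits , _) = from-twice-prefix (Gain⇒InitGain⊎TailGain gain)
    where
      1≤m = ≤-trans (s≤s z≤n) (subst (_≤ m) (+-suc o d) fits)
      d≤m = ≤-trans (m≤n+m d o) (fits-init fits)
      from-twice-prefix : InitGain o d ⊎ TailGain o d → ∃[ o′ ] ∃[ d′ ] Loss o′ d′
      from-twice-prefix (inj₁ (_ , twice , prefix)) =
        o , twice-prefix⇒Loss d o 1≤m d≤m (trans (cong (λ w → occ w cV) prefix) twice)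
              (subst (λ w → OccursAt w cV (suc o)) (sym prefix) (occursAt-factor-V o d (fits-init fits)))
      from-twice-prefix (inj₂ (_ , twice , prefix)) =
        suc o , twice-prefix⇒Loss d (suc o) 1≤m d≤m (trans (cong (λ w → occ w cV) prefix) twice)
                  (subst (λ w → OccursAt w cV (suc (suc o))) (sym prefix) (occursAt-factor-V (suc o) d (fits-tail fits)))

-- From positions in T to offsets in a window

sub-as-factor : ∀ {σ} (X : Str σ) a₀ j s t → suc a₀ ≤ s → t ≤ j →
                sub X s t ≡ factor (sub X (suc a₀) j) (s ∸ suc a₀) (suc t ∸ s)
sub-as-factor X a₀ j (suc s₀) t (s≤s a₀≤s₀) t≤j = sym (begin
  take (t ∸ s₀) (drop (s₀ ∸ a₀) (take (j ∸ a₀) (drop a₀ X)))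
    ≡⟨ cong (take (t ∸ s₀)) (drop-take (s₀ ∸ a₀) (j ∸ a₀) (drop a₀ X)) ⟩
  take (t ∸ s₀) (take (j ∸ a₀ ∸ (s₀ ∸ a₀)) (drop (s₀ ∸ a₀) (drop a₀ X)))
    ≡⟨ cong₂ (λ L Y → take (t ∸ s₀) (take L Y))
             (trans (∸-+-assoc j a₀ (s₀ ∸ a₀)) (cong (j ∸_) a₀+[s₀∸a₀]≡s₀))
             (trans (drop-drop a₀ (s₀ ∸ a₀) X) (cong (λ k → drop k X) a₀+[s₀∸a₀]≡s₀)) ⟩
  take (t ∸ s₀) (take (j ∸ s₀) (drop s₀ X))
    ≡⟨ take-take-≤ (drop s₀ X) (∸-monoˡ-≤ s₀ t≤j) ⟩
  take (t ∸ s₀) (drop s₀ X)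
    ∎)
  where
    open ≡-Reasoning
    a₀+[s₀∸a₀]≡s₀ : a₀ + (s₀ ∸ a₀) ≡ s₀
    a₀+[s₀∸a₀]≡s₀ = m+[n∸m]≡n a₀≤s₀

module _ {σ : ℕ} (X : Str σ) (a₀ j : ℕ) where
  private
    a = suc a₀
    W = sub X a j

    sub-factors : ∀ s t → a ≤ s → s ≤ t → t ≤ j →
      sub X s t ≡ factor W (s ∸ a) (suc (t ∸ s)) ×
      sub X (suc s) t ≡ factor W (suc (s ∸ a)) (t ∸ s) ×
      sub X s (t ∸ 1) ≡ factor W (s ∸ a) (t ∸ s)
    sub-factors s (suc t₀) a≤s s≤t t≤j =
      trans (sub-as-factor X a₀ j s (suc t₀) a≤s t≤j) (cong (factor W (s ∸ a)) (+-∸-assoc 1 s≤t)) ,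
      trans (sub-as-factor X a₀ j (suc s) (suc t₀) (m≤n⇒m≤1+n a≤s) t≤j)
            (cong (λ o → factor W o (suc t₀ ∸ s)) (+-∸-assoc 1 a≤s)) ,
      sub-as-factor X a₀ j s t₀ a≤s (≤-trans (n≤1+n t₀) t≤j)
    sub-factors (suc s) zero a≤s () _

  IsMUS⇒MinUnique : ∀ {s t} → IsMUS X a j (s , t) → MinUnique W (s ∸ a) (t ∸ s)
  IsMUS⇒MinUnique {s} {t} (a≤s , s≤t , t≤j , once , tail-repeats , init-repeats)
    with sub-factors s t a≤s s≤t t≤j
  ... | e₁ , e₂ , e₃ = subst (λ w → occ w W ≡ 1) e₁ once ,
                       subst (λ w → 2 ≤ occ w W) e₂ tail-repeats , subst (λ w → 2 ≤ occ w W) e₃ init-repeats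

  MinUnique⇒IsMUS : ∀ {s t} → a ≤ s → s ≤ t → t ≤ j → MinUnique W (s ∸ a) (t ∸ s) → IsMUS X a j (s , t)
  MinUnique⇒IsMUS {s} {t} a≤s s≤t t≤j (once , tail-repeats , init-repeats) with sub-factors s t a≤s s≤t t≤j
  ... | e₁ , e₂ , e₃ = a≤s , s≤t , t≤j , subst (λ w → occ w W ≡ 1) (sym e₁) once ,
                       subst (λ w → 2 ≤ occ w W) (sym e₂) tail-repeats , subst (λ w → 2 ≤ occ w W) (sym e₃) init-repeats

concatMap-pairs≡cartesianProduct : ∀ (ys xs : List ℕ) → concatMap (λ s → map (λ t → s , t) ys) xs ≡ cartesianProduct xs ys
concatMap-pairs≡cartesianProduct ys []       = refl
concatMap-pairs≡cartesianProduct ys (x ∷ xs) = cong (map (λ t → x , t) ys ++_) (concatMap-pairs≡cartesianProduct ys xs)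

candidates-unique : ∀ j → Unique (candidates j)
candidates-unique j = subst Unique (sym (concatMap-pairs≡cartesianProduct (upTo (suc j)) (upTo (suc j))))
  (cartesianProduct⁺ (upTo⁺ (suc j)) (upTo⁺ (suc j)))

∈-candidates : ∀ {j s t} → s ≤ j → t ≤ j → (s , t) ∈ candidates j
∈-candidates {j} {s} {t} s≤j t≤j = subst ((s , t) ∈_) (sym (concatMap-pairs≡cartesianProduct (upTo (suc j)) (upTo (suc j))))
  (∈-cartesianProduct⁺ (∈-upTo⁺ (s≤s s≤j)) (∈-upTo⁺ (s≤s t≤j)))

offsets-injective : ∀ {i s t s′ t′} → i ≤ s → s ≤ t → i ≤ s′ → s′ ≤ t′ →
                    s ∸ i ≡ s′ ∸ i → t ∸ s ≡ t′ ∸ s′ → (s , t) ≡ (s′ , t′)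
offsets-injective {i} i≤s s≤t i≤s′ s′≤t′ same-o same-d = cong₂ _,_ s≡s′
  (trans (sym (m+[n∸m]≡n s≤t)) (trans (cong₂ _+_ s≡s′ same-d) (m+[n∸m]≡n s′≤t′)))
  where s≡s′ = trans (sym (m+[n∸m]≡n i≤s)) (trans (cong (λ x → i + x) same-o) (m+[n∸m]≡n i≤s′))

open DecMembership (×-≡-dec _≟_ _≟_) using (_∈?_)

window-∷ : ∀ {σ} (X : Str σ) i₀ j → suc (suc i₀) ≤ j → j ≤ length X →
           ∃[ c ] (sub X (suc i₀) j ≡ c ∷ sub X (suc (suc i₀)) j)
window-∷ X i₀ j i₀+2≤j j≤∣X∣ with drop-∷ X i₀ (≤-trans (≤-trans (n≤1+n (suc i₀)) i₀+2≤j) j≤∣X∣)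
... | y , drop-i₀ = y , cong₂ take (+-∸-assoc 1 {j} {suc i₀} (≤-trans (n≤1+n (suc i₀)) i₀+2≤j)) drop-i₀

difference-from-sums : ∀ a b x y → a + x ≡ b + y → + a - + b ≡ y ⊖ x
difference-from-sums a b x y a+x≡b+y = begin
  + a - + b               ≡⟨ [+m]-[+n]≡m⊖n a b ⟩
  a ⊖ b                   ≡⟨ +-cancelˡ-⊖ x a b ⟨
  (x + a) ⊖ (x + b)       ≡⟨ cong₂ _⊖_ (trans (+-comm x a) a+x≡b+y) (+-comm x b) ⟩
  (b + y) ⊖ (b + x)       ≡⟨ +-cancelˡ-⊖ b y x ⟩
  y ⊖ x                   ∎
  where open ≡-Reasoning

module Windows {σ : ℕ} (X : Str σ) (i₀ j : ℕ) (i₀+2≤j : suc (suc i₀) ≤ j) (j≤∣X∣ : j ≤ length X)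
               (c : Fin σ) (V : Str σ) (cV-window : sub X (suc i₀) j ≡ c ∷ V) where
  open Prepend c V public

  V-window : sub X (suc (suc i₀)) j ≡ V
  V-window = ∷-injectiveʳ (trans (sym (proj₂ (window-∷ X i₀ j i₀+2≤j j≤∣X∣))) cV-window)

  i i′ : ℕ
  i  = suc (suc i₀)
  i′ = suc i₀

  MUS-cV MUS-V gained lost : List (ℕ × ℕ)
  MUS-cV = filter (isMUS? X i′ j) (candidates j)
  MUS-V  = filter (isMUS? X i j) (candidates j)
  gained = filter (λ p → ¬? (p ∈? MUS-V)) MUS-cV
  lost   = filter (λ p → ¬? (p ∈? MUS-cV)) MUS-V

  m≡j∸i′ : m ≡ j ∸ i′
  m≡j∸i′ = begin
    length V                                ≡⟨ cong length V-window ⟨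
    length (take (j ∸ i′) (drop i′ X))      ≡⟨ length-take (j ∸ i′) (drop i′ X) ⟩
    (j ∸ i′) ⊓ length (drop i′ X)           ≡⟨ cong ((j ∸ i′) ⊓_) (length-drop i′ X) ⟩
    (j ∸ i′) ⊓ (length X ∸ i′)              ≡⟨ m≤n⇒m⊓n≡m (∸-monoˡ-≤ i′ j≤∣X∣) ⟩
    j ∸ i′                                  ∎
    where open ≡-Reasoning

  i′+m≡j : i′ + m ≡ j
  i′+m≡j = trans (cong (λ x → i′ + x) m≡j∸i′) (m+[n∸m]≡n (≤-trans (n≤1+n i′) i₀+2≤j))

  offsets-fit : ∀ {s t} → i ≤ s → s ≤ t → t ≤ j → (s ∸ i) + suc (t ∸ s) ≤ m
  offsets-fit {s} {t} i≤s s≤t t≤j = +-cancelˡ-≤ i′ _ _ (begin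
    i′ + ((s ∸ i) + suc (t ∸ s))  ≡⟨ trans (cong (λ x → i′ + x) (+-suc (s ∸ i) (t ∸ s))) (+-suc i′ _) ⟩
    i + ((s ∸ i) + (t ∸ s))       ≡⟨ +-assoc i (s ∸ i) (t ∸ s) ⟨
    (i + (s ∸ i)) + (t ∸ s)       ≡⟨ cong (_+ (t ∸ s)) (m+[n∸m]≡n i≤s) ⟩
    s + (t ∸ s)                   ≡⟨ m+[n∸m]≡n s≤t ⟩
    t                             ≤⟨ t≤j ⟩
    j                             ≡⟨ i′+m≡j ⟨
    i′ + m                        ∎)
    where open ≤-Reasoning

  fits⇒≤j : ∀ {o d} → o + suc d ≤ m → i + o + d ≤ j
  fits⇒≤j {o} {d} fits = begin
    i + o + d        ≡⟨ +-assoc i o d ⟩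
    suc (i′ + (o + d)) ≡⟨ +-suc i′ (o + d) ⟨
    i′ + suc (o + d) ≡⟨ cong (λ x → i′ + x) (+-suc o d) ⟨
    i′ + (o + suc d) ≤⟨ +-monoʳ-≤ i′ fits ⟩
    i′ + m           ≡⟨ i′+m≡j ⟩
    j                ∎
    where open ≤-Reasoning

  IsMUS-V⇒MinUnique : ∀ {s t} → IsMUS X i j (s , t) → MinUnique V (s ∸ i) (t ∸ s)
  IsMUS-V⇒MinUnique {s} {t} mus = subst (λ W → MinUnique W (s ∸ i) (t ∸ s)) V-window (IsMUS⇒MinUnique X i′ j mus)

  MinUnique⇒IsMUS-V : ∀ {s t} → i ≤ s → s ≤ t → t ≤ j → MinUnique V (s ∸ i) (t ∸ s) → IsMUS X i j (s , t)
  MinUnique⇒IsMUS-V {s} {t} i≤s s≤t t≤j mu =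
    MinUnique⇒IsMUS X i′ j i≤s s≤t t≤j (subst (λ W → MinUnique W (s ∸ i) (t ∸ s)) (sym V-window) mu)

  IsMUS-cV⇒MinUnique : ∀ {s t} → IsMUS X i′ j (s , t) → MinUnique cV (s ∸ i′) (t ∸ s)
  IsMUS-cV⇒MinUnique {s} {t} mus = subst (λ W → MinUnique W (s ∸ i′) (t ∸ s)) cV-window (IsMUS⇒MinUnique X i₀ j mus)

  MinUnique⇒IsMUS-cV : ∀ {s t} → i′ ≤ s → s ≤ t → t ≤ j → MinUnique cV (s ∸ i′) (t ∸ s) → IsMUS X i′ j (s , t)
  MinUnique⇒IsMUS-cV {s} {t} i′≤s s≤t t≤j mu =
    MinUnique⇒IsMUS X i₀ j i′≤s s≤t t≤j (subst (λ W → MinUnique W (s ∸ i′) (t ∸ s)) (sym cV-window) mu)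

  ∸i′≡suc∸i : ∀ {s} → i ≤ s → s ∸ i′ ≡ suc (s ∸ i)
  ∸i′≡suc∸i {suc s₀} (s≤s i′≤s₀) = +-∸-assoc 1 i′≤s₀

  module _ {o d : ℕ} (fits : o + suc d ≤ m) where
    private
      s≤t : i + o ≤ i + o + d
      s≤t = m≤m+n (i + o) d
      offset-V : i + o ∸ i ≡ o
      offset-V = m+n∸m≡n i o
      offset-cV : i + o ∸ i′ ≡ suc o
      offset-cV = trans (∸i′≡suc∸i (m≤m+n i o)) (cong suc offset-V)
      length-d : i + o + d ∸ (i + o) ≡ d
      length-d = m+n∸m≡n (i + o) d

    ∈-candidates-at : (i + o , i + o + d) ∈ candidates j
    ∈-candidates-at = ∈-candidates (≤-trans s≤t (fits⇒≤j fits)) (fits⇒≤j fits)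

    MinUnique-V⇒IsMUS-at : MinUnique V o d → IsMUS X i j (i + o , i + o + d)
    MinUnique-V⇒IsMUS-at mu =
      MinUnique⇒IsMUS-V (m≤m+n i o) s≤t (fits⇒≤j fits) (subst₂ (MinUnique V) (sym offset-V) (sym length-d) mu)

    IsMUS-at⇒MinUnique-V : IsMUS X i j (i + o , i + o + d) → MinUnique V o d
    IsMUS-at⇒MinUnique-V mus = subst₂ (MinUnique V) offset-V length-d (IsMUS-V⇒MinUnique mus)

    MinUnique-cV⇒IsMUS-at : MinUnique cV (suc o) d → IsMUS X i′ j (i + o , i + o + d)
    MinUnique-cV⇒IsMUS-at mu = MinUnique⇒IsMUS-cV (≤-trans (n≤1+n i′) (m≤m+n i o)) s≤t (fits⇒≤j fits)
      (subst₂ (MinUnique cV) (sym offset-cV) (sym length-d) mu)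

    IsMUS-at⇒MinUnique-cV : IsMUS X i′ j (i + o , i + o + d) → MinUnique cV (suc o) d
    IsMUS-at⇒MinUnique-cV mus = subst₂ (MinUnique cV) offset-cV length-d (IsMUS-cV⇒MinUnique mus)

  ∈-gained⁻ : ∀ {p} → p ∈ gained → p ∈ candidates j × IsMUS X i′ j p × ¬ IsMUS X i j p
  ∈-gained⁻ p∈ with ∈-filter⁻ (λ q → ¬? (q ∈? MUS-V)) {xs = MUS-cV} p∈
  ... | p∈MUS-cV , p∉MUS-V with ∈-filter⁻ (isMUS? X i′ j) {xs = candidates j} p∈MUS-cV
  ...   | p∈cands , mus = p∈cands , mus , λ mus′ → p∉MUS-V (∈-filter⁺ (isMUS? X i j) p∈cands mus′)

  ∈-lost⁻ : ∀ {p} → p ∈ lost → p ∈ candidates j × IsMUS X i j p × ¬ IsMUS X i′ j p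
  ∈-lost⁻ p∈ with ∈-filter⁻ (λ q → ¬? (q ∈? MUS-cV)) {xs = MUS-V} p∈
  ... | p∈MUS-V , p∉MUS-cV with ∈-filter⁻ (isMUS? X i j) {xs = candidates j} p∈MUS-V
  ...   | p∈cands , mus = p∈cands , mus , λ mus′ → p∉MUS-cV (∈-filter⁺ (isMUS? X i′ j) p∈cands mus′)

  ∈-gained⁺ : ∀ {p} → p ∈ candidates j → IsMUS X i′ j p → ¬ IsMUS X i j p → p ∈ gained
  ∈-gained⁺ p∈cands mus ¬mus = ∈-filter⁺ (λ q → ¬? (q ∈? MUS-V)) (∈-filter⁺ (isMUS? X i′ j) p∈cands mus)
    (λ p∈MUS-V → ¬mus (proj₂ (∈-filter⁻ (isMUS? X i j) {xs = candidates j} p∈MUS-V)))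

  ∈-lost⁺ : ∀ {p} → p ∈ candidates j → IsMUS X i j p → ¬ IsMUS X i′ j p → p ∈ lost
  ∈-lost⁺ p∈cands mus ¬mus = ∈-filter⁺ (λ q → ¬? (q ∈? MUS-cV)) (∈-filter⁺ (isMUS? X i j) p∈cands mus)
    (λ p∈MUS-cV → ¬mus (proj₂ (∈-filter⁻ (isMUS? X i′ j) {xs = candidates j} p∈MUS-cV)))

  front⇒∈gained : ∀ {d} → d ≤ m → MinUnique cV 0 d → (i′ , i′ + d) ∈ gained
  front⇒∈gained {d} d≤m mu = ∈-gained⁺ (∈-candidates (≤-trans (m≤m+n i′ d) t≤j) t≤j)
    (MinUnique⇒IsMUS-cV ≤-refl (m≤m+n i′ d) t≤j (subst₂ (MinUnique cV) (sym (n∸n≡0 i′)) (sym (m+n∸m≡n i′ d)) mu))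
    (λ (i≤i′ , _) → 1+n≰n i≤i′)
    where t≤j = ≤-trans (+-monoʳ-≤ i′ d≤m) (≤-reflexive i′+m≡j)

  Gain⇒∈gained : ∀ {o d} → Gain o d → (i + o , i + o + d) ∈ gained
  Gain⇒∈gained (fits , mu , ¬mu) =
    ∈-gained⁺ (∈-candidates-at fits) (MinUnique-cV⇒IsMUS-at fits mu) (¬mu ∘′ IsMUS-at⇒MinUnique-V fits)

  Loss⇒∈lost : ∀ {o d} → Loss o d → (i + o , i + o + d) ∈ lost
  Loss⇒∈lost (fits , mu , ¬mu) =
    ∈-lost⁺ (∈-candidates-at fits) (MinUnique-V⇒IsMUS-at fits mu) (¬mu ∘′ IsMUS-at⇒MinUnique-cV fits)

  AtFront : ℕ × ℕ → Set
  AtFront (s , t) = s ≡ i′ × s ≤ t × MinUnique cV 0 (t ∸ s)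

  At : (ℕ → ℕ → Set) → ℕ × ℕ → Set
  At G (s , t) = i ≤ s × s ≤ t × G (s ∸ i) (t ∸ s)

  gained⇒AtFront⊎At-Gain : ∀ {p} → p ∈ gained → AtFront p ⊎ At Gain p
  gained⇒AtFront⊎At-Gain {s , t} p∈ with ∈-gained⁻ p∈
  ... | _ , mus@(i′≤s , s≤t , t≤j , _) , ¬mus with s ≟ i′
  ...   | yes s≡i′ = inj₁ (s≡i′ , s≤t , subst (λ o → MinUnique cV o (t ∸ s))
                                                (trans (cong (_∸ i′) s≡i′) (n∸n≡0 i′)) (IsMUS-cV⇒MinUnique mus))
  ...   | no s≢i′ = inj₂ (i≤s , s≤t , offsets-fit i≤s s≤t t≤j ,
                          subst (λ o → MinUnique cV o (t ∸ s)) (∸i′≡suc∸i i≤s) (IsMUS-cV⇒MinUnique mus) ,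
                          ¬mus ∘′ MinUnique⇒IsMUS-V i≤s s≤t t≤j)
    where i≤s = ≤∧≢⇒< i′≤s (s≢i′ ∘′ sym)

  lost⇒At-Loss : ∀ {p} → p ∈ lost → At Loss p
  lost⇒At-Loss {s , t} p∈ with ∈-lost⁻ p∈
  ... | _ , mus@(i≤s , s≤t , t≤j , _) , ¬mus =
        i≤s , s≤t , offsets-fit i≤s s≤t t≤j , IsMUS-V⇒MinUnique mus ,
        ¬mus ∘′ MinUnique⇒IsMUS-cV (≤-trans (n≤1+n i′) i≤s) s≤t t≤j
             ∘′ subst (λ o → MinUnique cV o (t ∸ s)) (sym (∸i′≡suc∸i i≤s))

  AtFront-unique : Subsingleton AtFront
  AtFront-unique {s , t} {s′ , t′} (refl , s≤t , mu) (refl , s′≤t′ , mu′) =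
    offsets-injective {i′} ≤-refl s≤t ≤-refl s′≤t′ refl (MinUnique-same-start {W = cV} {o = 0} mu mu′)

  At-unique : ∀ {G} → (∀ {o d o′ d′} → G o d → G o′ d′ → o ≡ o′ × d ≡ d′) → Subsingleton (At G)
  At-unique G-unique {s , t} {s′ , t′} (i≤s , s≤t , g) (i≤s′ , s′≤t′ , g′) with G-unique g g′
  ... | same-o , same-d = offsets-injective i≤s s≤t i≤s′ s′≤t′ same-o same-d

  gained-unique : Unique gained
  gained-unique = filter⁺ (λ q → ¬? (q ∈? MUS-V)) (filter⁺ (isMUS? X i′ j) (candidates-unique j))

  lost-unique : Unique lost
  lost-unique = filter⁺ (λ q → ¬? (q ∈? MUS-cV)) (filter⁺ (isMUS? X i j) (candidates-unique j))

  length-gained≤3 : length gained ≤ 3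
  length-gained≤3 = cover₃⇒length≤3 gained gained-unique classify
    AtFront-unique (At-unique InitGain-unique) (At-unique TailGain-unique)
    where
      classify : ∀ {p} → p ∈ gained → AtFront p ⊎ At InitGain p ⊎ At TailGain p
      classify {s , t} p∈ with gained⇒AtFront⊎At-Gain p∈
      ... | inj₁ front = inj₁ front
      ... | inj₂ (i≤s , s≤t , gain) =
            inj₂ (⊎-map (λ g → i≤s , s≤t , g) (λ g → i≤s , s≤t , g) (Gain⇒InitGain⊎TailGain gain))

  length-lost≤1 : length lost ≤ 1
  length-lost≤1 = subsingleton⇒length≤1 lost lost-unique lost⇒At-Loss (At-unique Loss-unique)

  length-gained≤1⊎lost≥1 : length gained ≤ 1 ⊎ 1 ≤ length lost
  length-gained≤1⊎lost≥1 with every⊎some gained gained⇒AtFront⊎At-Gain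
  ... | inj₁ all-front = inj₁ (subsingleton⇒length≤1 gained gained-unique all-front AtFront-unique)
  ... | inj₂ (_ , _ , (_ , _ , gain)) with Gain⇒Loss gain
  ...   | _ , _ , loss = inj₂ (∈-length (Loss⇒∈lost loss))

  MUS-difference : + length MUS-cV - + length MUS-V ≡ length gained ⊖ length lost
  MUS-difference = difference-from-sums (length MUS-cV) (length MUS-V) (length lost) (length gained)
    (length-filter-union (×-≡-dec _≟_ _≟_) (isMUS? X i′ j) (isMUS? X i j) (candidates j))


⊖-bounds : ∀ x y → x ≤ 1 → y ≤ 3 → y ≤ 1 ⊎ 1 ≤ x → -1ℤ ≤ℤ y ⊖ x × y ⊖ x ≤ℤ + 2
⊖-bounds 0 0 _ _ _ = -≤+ , +≤+ z≤n
⊖-bounds 0 1 _ _ _ = -≤+ , +≤+ (s≤s z≤n)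
⊖-bounds 0 (suc (suc _)) _ _ (inj₁ (s≤s ()))
⊖-bounds 1 0 _ _ _ = ≤ℤ-refl , -≤+
⊖-bounds 1 1 _ _ _ = -≤+ , +≤+ z≤n
⊖-bounds 1 2 _ _ _ = -≤+ , +≤+ (s≤s z≤n)
⊖-bounds 1 3 _ _ _ = -≤+ , +≤+ (s≤s (s≤s z≤n))
⊖-bounds 1 (suc (suc (suc (suc _)))) _ (s≤s (s≤s (s≤s ()))) _
⊖-bounds (suc (suc _)) _ (s≤s ()) _ _

MUS-difference-bounds : ∀ {σ n} (T : Vec (Fin σ) n) i j → 1 < i → i ≤ j → j ≤ n →
  symDiffSize (MUS T (i ∸ 1) j) (MUS T i j) ≤ 4
  × -1ℤ ≤ℤ (+ length (MUS T (i ∸ 1) j) - + length (MUS T i j))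
  × (+ length (MUS T (i ∸ 1) j) - + length (MUS T i j)) ≤ℤ + 2
MUS-difference-bounds T (suc (suc i₀)) j _ i₀+2≤j j≤n =
  +-mono-≤ W.length-gained≤3 W.length-lost≤1 ,
  subst (-1ℤ ≤ℤ_) (sym W.MUS-difference) (proj₁ bounds) , subst (_≤ℤ + 2) (sym W.MUS-difference) (proj₂ bounds)
  where
    j≤∣T∣ = subst (j ≤_) (sym (length-toList T)) j≤n
    split = window-∷ (toList T) i₀ j i₀+2≤j j≤∣T∣
    module W = Windows (toList T) i₀ j i₀+2≤j j≤∣T∣ (proj₁ split) (sub (toList T) (suc (suc i₀)) j) (proj₂ split)
    bounds = ⊖-bounds (length W.lost) (length W.gained) W.length-lost≤1 W.length-gained≤3 W.length-gained≤1⊎lost≥1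
MUS-difference-bounds T (suc zero) j (s≤s ()) _ _

-- Strings attaining the bounds

module _ {σ : ℕ} where

  indicator : ∀ {P : Set} → Dec P → ℕ
  indicator P? = if does P? then 1 else 0

  -- Agrees with occ, but unfolds on strings whose tail is not a literal.
  occ′ : Str σ → Str σ → ℕ
  occ′ w       (x ∷ W) = indicator (occursAt? w (x ∷ W) 0) + occ′ w W
  occ′ []      []      = 1
  occ′ (_ ∷ _) []      = 0

  occ≡occ′ : ∀ w W → occ w W ≡ occ′ w W
  occ≡occ′ w       (x ∷ W) = by-cases (occursAt? w (x ∷ W) 0)
    where
      by-cases : (d : Dec (take (length w) (x ∷ W) ≡ w)) → occ w (x ∷ W) ≡ indicator d + occ′ w W
      by-cases (yes prefix) = trans (occ-∷-prefix w x W prefix) (cong suc (occ≡occ′ w W))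
      by-cases (no ¬prefix) = trans (occ-∷-¬prefix w x W ¬prefix) (occ≡occ′ w W)
  occ≡occ′ []      []      = refl
  occ≡occ′ (_ ∷ _) []      = refl

  occ′-replicate : ∀ (z x : Fin σ) w r → x ≢ z → occ′ (x ∷ w) (replicate r z) ≡ 0
  occ′-replicate z x w zero    x≢z = refl
  occ′-replicate z x w (suc r) x≢z = cong₂ _+_ (not-prefix (occursAt? (x ∷ w) (replicate (suc r) z) 0))
                                               (occ′-replicate z x w r x≢z)
    where
      not-prefix : (d : Dec (take (length (x ∷ w)) (replicate (suc r) z) ≡ x ∷ w)) → indicator d ≡ 0
      not-prefix (yes prefix) = contradiction (sym (∷-injectiveˡ prefix)) x≢z
      not-prefix (no _)       = refl

module Padded {σ : ℕ} (z c : Fin σ) (V : Str σ) (1≤∣V∣ : 1 ≤ length V) (i₀ j n : ℕ)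
              (j≡ : j ≡ i₀ + suc (length V)) (j≤n : j ≤ n) where

  X : Str σ
  X = replicate i₀ z ++ (c ∷ V) ++ replicate (n ∸ j) z

  length-X : length X ≡ n
  length-X = begin
    length X                                          ≡⟨ length-++ (replicate i₀ z) ⟩
    length (replicate i₀ z) + length ((c ∷ V) ++ replicate (n ∸ j) z)
      ≡⟨ cong₂ _+_ (length-replicate i₀)
                   (trans (length-++ (c ∷ V)) (cong (λ l → suc (length V) + l) (length-replicate (n ∸ j)))) ⟩
    i₀ + (suc (length V) + (n ∸ j))                   ≡⟨ +-assoc i₀ (suc (length V)) (n ∸ j) ⟨
    i₀ + suc (length V) + (n ∸ j)                     ≡⟨ cong (_+ (n ∸ j)) j≡ ⟨
    j + (n ∸ j)                                       ≡⟨ m+[n∸m]≡n j≤n ⟩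
    n                                                 ∎
    where open ≡-Reasoning

  cV-window : sub X (suc i₀) j ≡ c ∷ V
  cV-window = trans (cong₂ take (trans (cong (_∸ i₀) j≡) (m+n∸m≡n i₀ (suc (length V))))
                                (drop-replicate-++ z i₀ ((c ∷ V) ++ replicate (n ∸ j) z)))
                    (cong (c ∷_) (take-length-++ V (replicate (n ∸ j) z)))

  i₀+2≤j : suc (suc i₀) ≤ j
  i₀+2≤j = subst (suc (suc i₀) ≤_) (sym j≡)
             (subst (_≤ i₀ + suc (length V)) (+-comm i₀ 2) (+-monoʳ-≤ i₀ (s≤s 1≤∣V∣)))

  open Windows X i₀ j i₀+2≤j (subst (j ≤_) (sym length-X) j≤n) c V cV-window public

  realize : (P : Str σ → Set) → P X → ∃[ T ] P (toList {n = n} T)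
  realize P px with fromList-of-length X length-X
  ... | T , toList-T = T , subst P (sym toList-T) px

module Letters (k : ℕ) where
  l₀ l₁ l₂ : Fin (3 + k)
  l₀ = Fin.zero
  l₁ = Fin.suc Fin.zero
  l₂ = Fin.suc (Fin.suc Fin.zero)

-- cV = 1 2 2 1 0 0 0^r: the MUSs 12, 21, 10 appear and the MUS 1 of V disappears.
module Example₁ (k r : ℕ) where
  open Letters k

  V : Str (3 + k)
  V = l₂ ∷ l₂ ∷ l₁ ∷ l₀ ∷ l₀ ∷ replicate r l₀

  cV : Str (3 + k)
  cV = l₁ ∷ V

  occ-12 : occ (l₁ ∷ l₂ ∷ []) cV ≡ 1
  occ-12 = trans (occ≡occ′ (l₁ ∷ l₂ ∷ []) cV) (cong suc (occ′-replicate l₀ l₁ (l₂ ∷ []) r (λ ())))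

  occ-21 : occ (l₂ ∷ l₁ ∷ []) cV ≡ 1
  occ-21 = trans (occ≡occ′ (l₂ ∷ l₁ ∷ []) cV) (cong suc (occ′-replicate l₀ l₂ (l₁ ∷ []) r (λ ())))

  occ-10 : occ (l₁ ∷ l₀ ∷ []) cV ≡ 1
  occ-10 = trans (occ≡occ′ (l₁ ∷ l₀ ∷ []) cV) (cong suc (occ′-replicate l₀ l₁ (l₀ ∷ []) r (λ ())))

  occ-1-V : occ (l₁ ∷ []) V ≡ 1
  occ-1-V = trans (occ≡occ′ (l₁ ∷ []) V) (cong suc (occ′-replicate l₀ l₁ [] r (λ ())))

  occ-1 : 2 ≤ occ (l₁ ∷ []) cV
  occ-1 = occ≥2 {w = l₁ ∷ []} {W = cV} {a = 0} {b = 3} (z≤n , refl) (m≤m+n 3 _ , refl) (λ ())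

  occ-2 : 2 ≤ occ (l₂ ∷ []) cV
  occ-2 = occ≥2 {w = l₂ ∷ []} {W = cV} {a = 1} {b = 2} (m≤m+n 1 _ , refl) (m≤m+n 2 _ , refl) (λ ())

  occ-0 : 2 ≤ occ (l₀ ∷ []) cV
  occ-0 = occ≥2 {w = l₀ ∷ []} {W = cV} {a = 4} {b = 5} (m≤m+n 4 _ , refl) (m≤m+n 5 _ , refl) (λ ())

  occ-ε-V : 2 ≤ occ [] V
  occ-ε-V = occ≥2 {w = []} {W = V} {a = 0} {b = 1} (z≤n , refl) (m≤m+n 1 _ , refl) (λ ())

  module Window (i₀ j n : ℕ) (j≡ : j ≡ i₀ + suc (length V)) (j≤n : j ≤ n) where
    open Padded l₀ l₁ V (s≤s z≤n) i₀ j n j≡ j≤n public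

    gain-21 : Gain 1 1
    gain-21 = s≤s (s≤s (s≤s z≤n)) , (occ-21 , occ-1 , occ-2) ,
              λ (_ , tail-repeats , _) → ¬2≤1 (subst (2 ≤_) occ-1-V tail-repeats)

    gain-10 : Gain 2 1
    gain-10 = s≤s (s≤s (s≤s (s≤s z≤n))) , (occ-10 , occ-0 , occ-1) ,
              λ (_ , _ , init-repeats) → ¬2≤1 (subst (2 ≤_) occ-1-V init-repeats)

    loss-1 : Loss 2 0
    loss-1 = s≤s (s≤s (s≤s z≤n)) , (occ-1-V , occ-ε-V , occ-ε-V) ,
             λ (once , _) → ¬2≤1 (subst (2 ≤_) once occ-1)

    length-gained≡3 : length gained ≡ 3
    length-gained≡3 = ≤-antisym length-gained≤3 (unique⊆⇒length≤ {ys = p₀ ∷ p₁ ∷ p₂ ∷ []}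
      ((p₀≢p₁ ∷ p₀≢p₂ ∷ []) ∷ (p₁≢p₂ ∷ []) ∷ [] ∷ [])
      λ { (here refl) → front⇒∈gained {d = 1} (s≤s z≤n) (occ-12 , occ-2 , occ-1)
        ; (there (here refl)) → Gain⇒∈gained gain-21
        ; (there (there (here refl))) → Gain⇒∈gained gain-10 })
      where
        p₀ p₁ p₂ : ℕ × ℕ
        p₀ = i′ , i′ + 1
        p₁ = i + 1 , i + 1 + 1
        p₂ = i + 2 , i + 2 + 1
        p₀≢p₁ : p₀ ≢ p₁
        p₀≢p₁ e = m≢1+m+n i′ (cong proj₁ e)
        p₀≢p₂ : p₀ ≢ p₂
        p₀≢p₂ e = m≢1+m+n i′ (cong proj₁ e)
        p₁≢p₂ : p₁ ≢ p₂
        p₁≢p₂ e with +-cancelˡ-≡ i 1 2 (cong proj₁ e)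
        ... | ()

    length-lost≡1 : length lost ≡ 1
    length-lost≡1 = ≤-antisym length-lost≤1 (∈-length (Loss⇒∈lost {o = 2} {d = 0} loss-1))

-- cV = 1 1 2 1 1 0 0^r: no MUS appears and the MUS 11 of V disappears.
module Example₂ (k r : ℕ) where
  open Letters k

  V : Str (3 + k)
  V = l₁ ∷ l₂ ∷ l₁ ∷ l₁ ∷ l₀ ∷ replicate r l₀

  open Prepend l₁ V using (cV; InitGain; TailGain; occursAt-factor-V; fits-init; fits-tail)

  occ-12 : occ (l₁ ∷ l₂ ∷ []) cV ≡ 1
  occ-12 = trans (occ≡occ′ (l₁ ∷ l₂ ∷ []) cV) (cong suc (occ′-replicate l₀ l₁ (l₂ ∷ []) r (λ ())))

  occ-112 : occ (l₁ ∷ l₁ ∷ l₂ ∷ []) cV ≡ 1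
  occ-112 = trans (occ≡occ′ (l₁ ∷ l₁ ∷ l₂ ∷ []) cV) (cong suc (occ′-replicate l₀ l₁ (l₁ ∷ l₂ ∷ []) r (λ ())))

  occ-10 : occ (l₁ ∷ l₀ ∷ []) cV ≡ 1
  occ-10 = trans (occ≡occ′ (l₁ ∷ l₀ ∷ []) cV) (cong suc (occ′-replicate l₀ l₁ (l₀ ∷ []) r (λ ())))

  occ-21 : occ (l₂ ∷ l₁ ∷ []) cV ≡ 1
  occ-21 = trans (occ≡occ′ (l₂ ∷ l₁ ∷ []) cV) (cong suc (occ′-replicate l₀ l₂ (l₁ ∷ []) r (λ ())))

  occ-11 : occ (l₁ ∷ l₁ ∷ []) cV ≡ 2
  occ-11 = trans (occ≡occ′ (l₁ ∷ l₁ ∷ []) cV) (cong (λ x → suc (suc x)) (occ′-replicate l₀ l₁ (l₁ ∷ []) r (λ ())))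

  occ-11-V : occ (l₁ ∷ l₁ ∷ []) V ≡ 1
  occ-11-V = trans (occ≡occ′ (l₁ ∷ l₁ ∷ []) V) (cong suc (occ′-replicate l₀ l₁ (l₁ ∷ []) r (λ ())))

  occ-1-V : 2 ≤ occ (l₁ ∷ []) V
  occ-1-V = occ≥2 {w = l₁ ∷ []} {W = V} {a = 0} {b = 2} (z≤n , refl) (m≤m+n 2 _ , refl) (λ ())

  occ-1 : 3 ≤ occ (l₁ ∷ []) cV
  occ-1 = occ≥3 {w = l₁ ∷ []} {W = cV} {a = 0} {b = 1} {c = 3} (z≤n , refl) (m≤m+n 1 _ , refl)
                (m≤m+n 3 _ , refl) (λ ()) (λ ()) (λ ())

  occ-ε : 3 ≤ occ [] cV
  occ-ε = occ≥3 {w = []} {W = cV} {a = 0} {b = 1} {c = 2} (z≤n , refl) (m≤m+n 1 _ , refl)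
                (m≤m+n 2 _ , refl) (λ ()) (λ ()) (λ ())

  11-at-0 : OccursAt (l₁ ∷ l₁ ∷ []) cV 0
  11-at-0 = z≤n , refl

  11-at-3 : OccursAt (l₁ ∷ l₁ ∷ []) cV 3
  11-at-3 = m≤m+n 3 _ , refl

  no-MinUnique-at-0 : ∀ d → ¬ MinUnique cV 0 d
  no-MinUnique-at-0 0             (once , _)            = ≥2⇒≢1 (≤-trans (s≤s (s≤s z≤n)) occ-1) once
  no-MinUnique-at-0 1             (once , _)            = ≥2⇒≢1 (≤-reflexive (sym occ-11)) once
  no-MinUnique-at-0 (suc (suc d)) (_ , tail-repeats , _) =
    ≥2⇒≢1 (≤-trans tail-repeats (occ-take-≥ (factor cV 1 (suc (suc d))) cV 2)) occ-12

  twice-prefix⇒length≡2 : ∀ d → occ (take d cV) cV ≡ 2 → d ≡ 2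
  twice-prefix⇒length≡2 0 twice = contradiction (subst (3 ≤_) twice occ-ε) λ { (s≤s (s≤s ())) }
  twice-prefix⇒length≡2 1 twice = contradiction (subst (3 ≤_) twice occ-1) λ { (s≤s (s≤s ())) }
  twice-prefix⇒length≡2 2 _     = refl
  twice-prefix⇒length≡2 (suc (suc (suc d))) twice =
    ⊥-elim (≥2⇒≢1 (≤-trans (≤-reflexive (sym twice)) (occ-take-≥ (take (3 + d) cV) cV 3)) occ-112)

  no-InitGain : ∀ {o d} → ¬ InitGain o d
  no-InitGain {o} {d} ((fits , (_ , tail-repeats , _) , _) , twice , prefix)
    with twice-prefix⇒length≡2 d (trans (cong (λ w → occ w cV) prefix) twice)
  ... | refl with occ≡2⇒later-position-unique occ-11 11-at-0 11-at-3
                    (subst (λ w → OccursAt w cV (suc o)) (sym prefix) (occursAt-factor-V o 2 (fits-init fits)))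
  ...   | refl = ≥2⇒≢1 tail-repeats occ-10

  no-TailGain : ∀ {o d} → ¬ TailGain o d
  no-TailGain {o} {d} ((fits , (_ , _ , init-repeats) , _) , twice , prefix)
    with twice-prefix⇒length≡2 d (trans (cong (λ w → occ w cV) prefix) twice)
  ... | refl with occ≡2⇒later-position-unique occ-11 11-at-0 11-at-3
                    (subst (λ w → OccursAt w cV (suc (suc o))) (sym prefix) (occursAt-factor-V (suc o) 2 (fits-tail fits)))
  ...   | refl = ≥2⇒≢1 init-repeats occ-21

  module Window (i₀ j n : ℕ) (j≡ : j ≡ i₀ + suc (length V)) (j≤n : j ≤ n) where
    open Padded l₀ l₁ V (s≤s z≤n) i₀ j n j≡ j≤n public

    loss-11 : Loss 2 1
    loss-11 = s≤s (s≤s (s≤s (s≤s z≤n))) , (occ-11-V , occ-1-V , occ-1-V) , λ (once , _) → ≥2⇒≢1 (≤-reflexive (sym occ-11)) once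

    length-gained≡0 : length gained ≡ 0
    length-gained≡0 = n≤0⇒n≡0 (unique⊆⇒length≤ {zs = []} gained-unique (⊥-elim ∘′ nothing-gained))
      where
        nothing-gained : ∀ {p} → p ∈ gained → ⊥
        nothing-gained {s , t} p∈ with gained⇒AtFront⊎At-Gain p∈
        ... | inj₁ (_ , _ , mu) = no-MinUnique-at-0 (t ∸ s) mu
        ... | inj₂ (_ , _ , gain) = [ no-InitGain , no-TailGain ]′ (Gain⇒InitGain⊎TailGain gain)

    length-lost≡1 : length lost ≡ 1
    length-lost≡1 = ≤-antisym length-lost≤1 (∈-length (Loss⇒∈lost {o = 2} {d = 1} loss-11))

long-window : ∀ i₀ j → suc (suc i₀) ≤ j → 5 ≤ j + 1 ∸ suc (suc i₀) → ∃[ r ] (j ≡ i₀ + (6 + r))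
long-window i₀ j i≤j 5≤ = j ∸ (i₀ + 6) , sym (trans (sym (+-assoc i₀ 6 (j ∸ (i₀ + 6)))) (m+[n∸m]≡n i₀+6≤j))
  where
    i₀+6≤j : i₀ + 6 ≤ j
    i₀+6≤j = subst (_≤ j) (+-comm 6 i₀)
      (m≤o∸n⇒m+n≤o 5 (≤-trans (n≤1+n (suc i₀)) i≤j) (subst (λ x → 5 ≤ x ∸ suc (suc i₀)) (+-comm j 1) 5≤))

MUS-difference-attained : ∀ {σ} n i j → 3 ≤ σ → 1 < i → i ≤ j → j ≤ n → 5 ≤ j + 1 ∸ i →
  ∃ (λ (T : Vec (Fin σ) n) → symDiffSize (MUS T (i ∸ 1) j) (MUS T i j) ≡ 4)
  × ∃ (λ (T : Vec (Fin σ) n) → (+ length (MUS T (i ∸ 1) j) - + length (MUS T i j)) ≡ + 2)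
  × ∃ (λ (T : Vec (Fin σ) n) → (+ length (MUS T (i ∸ 1) j) - + length (MUS T i j)) ≡ -1ℤ)
MUS-difference-attained {suc (suc (suc k))} n (suc (suc i₀)) j _ _ i≤j j≤n 5≤ with long-window i₀ j i≤j 5≤
... | r , j≡ =
  E₁.realize (λ Y → symDiffSize (MUS-of Y) (MUS-of′ Y) ≡ 4) (cong₂ _+_ E₁.length-gained≡3 E₁.length-lost≡1) ,
  E₁.realize (λ Y → + length (MUS-of Y) - + length (MUS-of′ Y) ≡ + 2)
             (trans E₁.MUS-difference (cong₂ _⊖_ E₁.length-gained≡3 E₁.length-lost≡1)) ,
  E₂.realize (λ Y → + length (MUS-of Y) - + length (MUS-of′ Y) ≡ -1ℤ)
             (trans E₂.MUS-difference (cong₂ _⊖_ E₂.length-gained≡0 E₂.length-lost≡1))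
  where
    MUS-of MUS-of′ : Str (3 + k) → List (ℕ × ℕ)
    MUS-of  Y = filter (isMUS? Y (suc i₀) j) (candidates j)
    MUS-of′ Y = filter (isMUS? Y (suc (suc i₀)) j) (candidates j)
    j≡ᵣ : ∀ {V′ : Str (3 + k)} → length V′ ≡ 5 + r → j ≡ i₀ + suc (length V′)
    j≡ᵣ ∣V′∣ = trans j≡ (cong (λ l → i₀ + suc l) (sym ∣V′∣))
    ∣tail∣ : length (replicate r (Letters.l₀ k)) ≡ r
    ∣tail∣ = length-replicate r
    module E₁ = Example₁.Window k r i₀ j n (j≡ᵣ {Example₁.V k r} (cong (λ l → 5 + l) ∣tail∣)) j≤n
    module E₂ = Example₂.Window k r i₀ j n (j≡ᵣ {Example₂.V k r} (cong (λ l → 5 + l) ∣tail∣)) j≤n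
MUS-difference-attained n (suc zero) j _ (s≤s ()) _ _ _
MUS-difference-attained {suc zero} n (suc (suc _)) j (s≤s ()) _ _ _ _
MUS-difference-attained {suc (suc zero)} n (suc (suc _)) j (s≤s (s≤s ())) _ _ _ _

theorem2 :
    (∀ (σ : ℕ) → 2 ≤ σ → ∀ (n : ℕ) (T : Vec (Fin σ) n) (i j : ℕ) → 1 < i → i ≤ j → j ≤ n →
       symDiffSize (MUS T (i ∸ 1) j) (MUS T i j) ≤ 4
       × -1ℤ ≤ℤ (+ length (MUS T (i ∸ 1) j) - + length (MUS T i j))
       × (+ length (MUS T (i ∸ 1) j) - + length (MUS T i j)) ≤ℤ + 2)
    ×
    (∀ (σ n i j : ℕ) → 3 ≤ σ → 1 < i → i ≤ j → j ≤ n → 5 ≤ j + 1 ∸ i →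
       ∃ (λ (T : Vec (Fin σ) n) → symDiffSize (MUS T (i ∸ 1) j) (MUS T i j) ≡ 4)
       × ∃ (λ (T : Vec (Fin σ) n) → (+ length (MUS T (i ∸ 1) j) - + length (MUS T i j)) ≡ + 2)
       × ∃ (λ (T : Vec (Fin σ) n) → (+ length (MUS T (i ∸ 1) j) - + length (MUS T i j)) ≡ -1ℤ))
theorem2 = (λ _ _ _ T → MUS-difference-bounds T) , (λ _ → MUS-difference-attained)  -- the bounds need no σ ≥ 2
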